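{- The functor $\Gamma\colon \mathsf{ULM}\to\mathsf{MVM}$ is an equivalence of categories. Here, for a unital commutative lattice-ordered monoid $M$, $\Gamma(M)=\{x\in M\mid 0\le x\le 1\}$ with $\vee,\wedge,0,1$ restricted from $M$ and $x\oplus y=(x+y)\wedge 1$, $x\odot y=(x+y+(-1))\vee 0$; for a homomorphism $f\colon M\to N$, $\Gamma(f)$ is the restriction of $f$ to $\Gamma(M)\to\Gamma(N)$.
   Context: A commutative lattice-ordered monoid is an algebra $\langle M;+,\vee,\wedge,0\rangle$ such that $\langle M;\vee,\wedge\rangle$ is a distributive lattice, $\langle M;+,0\rangle$ is a commutative monoid, and $+$ distributes over both $\vee$ and $\wedge$. A unital commutative lattice-ordered monoid is an algebra $\langle M;+,\vee,\wedge,0,1,-1\rangle$ (arities $2,2,2,0,0,0$) such that $\langle M;+,\vee,\wedge,0\rangle$ is a commutative lattice-ordered monoid, $-1+1=0$, $0\le 1$, and for every $x\in M$ there is $n\in\mathbb{N}$ with $(-1)+\dots+(-1)\le x\le 1+\dots+1$ ($n$ summands each). $\mathsf{ULM}$ is the category of these algebras with homomorphisms. An MV-monoidal algebra is an algebra $\langle A;\oplus,\odot,\vee,\wedge,0,1\rangle$ (arities $2,2,2,2,0,0$) satisfying: (A1) $\langle A;\vee,\wedge\rangle$ is a distributive lattice; (A2) $\langle A;\oplus,0\rangle$ and $\langle A;\odot,1\rangle$ are commutative monoids; (A3) both $\oplus$ and $\odot$ distribute over both $\vee$ and $\wedge$; (A4) $(x\oplus y)\odot((x\odot y)\oplus z)=(x\odot(y\oplus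 z))\oplus(y\odot z)$; (A5) $(x\odot y)\oplus((x\oplus y)\odot z)=(x\oplus(y\odot z))\odot(y\oplus z)$; (A6) $(x\odot y)\oplus z=((x\oplus y)\odot((x\odot y)\oplus z))\vee z$; (A7) $(x\oplus y)\odot z=((x\odot y)\oplus((x\oplus y)\odot z))\wedge z$. $\mathsf{MVM}$ is the category of MV-monoidal algebras with homomorphisms. (That $\Gamma$ is a well-defined functor into $\mathsf{MVM}$ is part of the setting.) -}

module Defs where

open import Level using (Level; _⊔_) renaming (suc to lsuc)
open import Data.Nat using (ℕ; zero; suc)
open import Data.Product using (Σ; ∃; _×_; _,_; proj₁; proj₂)
open import Relation.Binary.Core using (Rel)
open import Relation.Binary.Structures using (IsEquivalence)
open import Algebra.Core using (Op₂)
open import Algebra.Definitions using (_DistributesOver_)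
open import Algebra.Structures using (IsCommutativeMonoid)
open import Algebra.Lattice.Structures using (IsDistributiveLattice)
open import Algebra.Lattice.Bundles using (Lattice)
import Algebra.Lattice.Properties.Lattice as LatticeProperties
import Relation.Binary.Lattice as R
import Relation.Binary.Reasoning.Setoid as SetoidReasoning
open import Relation.Binary.Bundles using (Setoid)

iterate-sum : ∀ {a} {A : Set a} → Op₂ A → A → ℕ → A → A
iterate-sum _+_ e zero    a = e
iterate-sum _+_ e (suc n) a = a + iterate-sum _+_ e n a

record ULM (c ℓ : Level) : Set (lsuc (c ⊔ ℓ)) where
  infixl 6 _+_
  infixr 7 _·_
  infixr 7 _∨_
  infixr 8 _∧_
  infix 4 _≈_ _≤_
  field
    Carrier : Set c
    _≈_     : Rel Carrier ℓ
    _+_     : Op₂ Carrier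
    _∨_     : Op₂ Carrier
    _∧_     : Op₂ Carrier
    0#      : Carrier
    1#      : Carrier
    -1#     : Carrier
    isDistributiveLattice : IsDistributiveLattice _≈_ _∨_ _∧_
    +-isCommutativeMonoid : IsCommutativeMonoid _≈_ _+_ 0#
    +-distrib-∨ : _DistributesOver_ _≈_ _+_ _∨_
    +-distrib-∧ : _DistributesOver_ _≈_ _+_ _∧_

  _≤_ : Rel Carrier ℓ
  x ≤ y = x ≈ x ∧ y

  _·_ : ℕ → Carrier → Carrier
  n · a = iterate-sum _+_ 0# n a

  field
    -1+1≈0   : -1# + 1# ≈ 0#
    0≤1      : 0# ≤ 1#
    strongUnit : ∀ x → ∃ λ n → (n · -1#) ≤ x × x ≤ (n · 1#)

  open IsDistributiveLattice isDistributiveLattice public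
  open IsCommutativeMonoid +-isCommutativeMonoid public
    using () renaming (assoc to +-assoc; comm to +-comm; identityʳ to +-identityʳ;
                       identityˡ to +-identityˡ; ∙-cong to +-cong)

record ULMHom {c₁ ℓ₁ c₂ ℓ₂} (M : ULM c₁ ℓ₁) (N : ULM c₂ ℓ₂)
       : Set (c₁ ⊔ ℓ₁ ⊔ c₂ ⊔ ℓ₂) where
  private
    module M = ULM M
    module N = ULM N
  field
    ⟦_⟧   : M.Carrier → N.Carrier
    cong  : ∀ {x y} → x M.≈ y → ⟦ x ⟧ N.≈ ⟦ y ⟧
    +-hom : ∀ x y → ⟦ x M.+ y ⟧ N.≈ ⟦ x ⟧ N.+ ⟦ y ⟧
    ∨-hom : ∀ x y → ⟦ x M.∨ y ⟧ N.≈ ⟦ x ⟧ N.∨ ⟦ y ⟧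
    ∧-hom : ∀ x y → ⟦ x M.∧ y ⟧ N.≈ ⟦ x ⟧ N.∧ ⟦ y ⟧
    0-hom : ⟦ M.0# ⟧ N.≈ N.0#
    1-hom : ⟦ M.1# ⟧ N.≈ N.1#
    -1-hom : ⟦ M.-1# ⟧ N.≈ N.-1#

record RawMVM (c ℓ : Level) : Set (lsuc (c ⊔ ℓ)) where
  infix 4 _≈_
  field
    Carrier : Set c
    _≈_     : Rel Carrier ℓ
    isEquivalence : IsEquivalence _≈_
    _⊕_ _⊙_ _∨_ _∧_ : Op₂ Carrier
    0# 1# : Carrier

record MVMHom {c₁ ℓ₁ c₂ ℓ₂} (A : RawMVM c₁ ℓ₁) (B : RawMVM c₂ ℓ₂)
       : Set (c₁ ⊔ ℓ₁ ⊔ c₂ ⊔ ℓ₂) where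
  private
    module A = RawMVM A
    module B = RawMVM B
  field
    ⟦_⟧   : A.Carrier → B.Carrier
    cong  : ∀ {x y} → x A.≈ y → ⟦ x ⟧ B.≈ ⟦ y ⟧
    ⊕-hom : ∀ x y → ⟦ x A.⊕ y ⟧ B.≈ ⟦ x ⟧ B.⊕ ⟦ y ⟧
    ⊙-hom : ∀ x y → ⟦ x A.⊙ y ⟧ B.≈ ⟦ x ⟧ B.⊙ ⟦ y ⟧
    ∨-hom : ∀ x y → ⟦ x A.∨ y ⟧ B.≈ ⟦ x ⟧ B.∨ ⟦ y ⟧
    ∧-hom : ∀ x y → ⟦ x A.∧ y ⟧ B.≈ ⟦ x ⟧ B.∧ ⟦ y ⟧
    0-hom : ⟦ A.0# ⟧ B.≈ B.0#
    1-hom : ⟦ A.1# ⟧ B.≈ B.1#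

record MVMIso {c₁ ℓ₁ c₂ ℓ₂} (A : RawMVM c₁ ℓ₁) (B : RawMVM c₂ ℓ₂)
       : Set (c₁ ⊔ ℓ₁ ⊔ c₂ ⊔ ℓ₂) where
  private
    module A = RawMVM A
    module B = RawMVM B
  field
    to   : MVMHom A B
    from : MVMHom B A
    from∘to : ∀ x → MVMHom.⟦ from ⟧ (MVMHom.⟦ to ⟧ x) A.≈ x
    to∘from : ∀ y → MVMHom.⟦ to ⟧ (MVMHom.⟦ from ⟧ y) B.≈ y

record MVM (c ℓ : Level) : Set (lsuc (c ⊔ ℓ)) where
  infixl 6 _⊕_
  infixl 7 _⊙_
  infixr 5 _∨_
  infixr 5 _∧_
  infix 4 _≈_
  field
    Carrier : Set c
    _≈_     : Rel Carrier ℓ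
    _⊕_ _⊙_ _∨_ _∧_ : Op₂ Carrier
    0# 1# : Carrier
    isDistributiveLattice : IsDistributiveLattice _≈_ _∨_ _∧_
    ⊕-isCommutativeMonoid : IsCommutativeMonoid _≈_ _⊕_ 0#
    ⊙-isCommutativeMonoid : IsCommutativeMonoid _≈_ _⊙_ 1#
    ⊕-distrib-∨ : _DistributesOver_ _≈_ _⊕_ _∨_
    ⊕-distrib-∧ : _DistributesOver_ _≈_ _⊕_ _∧_
    ⊙-distrib-∨ : _DistributesOver_ _≈_ _⊙_ _∨_
    ⊙-distrib-∧ : _DistributesOver_ _≈_ _⊙_ _∧_
    A4 : ∀ x y z → (x ⊕ y) ⊙ ((x ⊙ y) ⊕ z) ≈ (x ⊙ (y ⊕ z)) ⊕ (y ⊙ z)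
    A5 : ∀ x y z → (x ⊙ y) ⊕ ((x ⊕ y) ⊙ z) ≈ (x ⊕ (y ⊙ z)) ⊙ (y ⊕ z)
    A6 : ∀ x y z → (x ⊙ y) ⊕ z ≈ ((x ⊕ y) ⊙ ((x ⊙ y) ⊕ z)) ∨ z
    A7 : ∀ x y z → (x ⊕ y) ⊙ z ≈ ((x ⊙ y) ⊕ ((x ⊕ y) ⊙ z)) ∧ z

  raw : RawMVM c ℓ
  raw = record
    { Carrier = Carrier ; _≈_ = _≈_
    ; isEquivalence = IsDistributiveLattice.isEquivalence isDistributiveLattice
    ; _⊕_ = _⊕_ ; _⊙_ = _⊙_ ; _∨_ = _∨_ ; _∧_ = _∧_ ; 0# = 0# ; 1# = 1# }

module ULMLemmas {c ℓ} (M : ULM c ℓ) where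
  open ULM M

  lattice : Lattice c ℓ
  lattice = record { isLattice = isLattice }

  open R.IsLattice (LatticeProperties.∨-∧-isOrderTheoreticLattice lattice) public
    using (supremum; infimum) renaming (trans to ≤-trans; refl to ≤-refl;
                                         reflexive to ≤-reflexive)
  open SetoidReasoning (Lattice.setoid lattice)

  x∧y≤x : ∀ x y → x ∧ y ≤ x
  x∧y≤x x y = proj₁ (infimum x y)

  x∧y≤y : ∀ x y → x ∧ y ≤ y
  x∧y≤y x y = proj₁ (proj₂ (infimum x y))

  ∧-greatest : ∀ {x y z} → z ≤ x → z ≤ y → z ≤ x ∧ y
  ∧-greatest {x} {y} {z} p q = proj₂ (proj₂ (infimum x y)) z p q

  x≤x∨y : ∀ x y → x ≤ x ∨ y
  x≤x∨y x y = proj₁ (supremum x y)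

  y≤x∨y : ∀ x y → y ≤ x ∨ y
  y≤x∨y x y = proj₁ (proj₂ (supremum x y))

  ∨-least : ∀ {x y z} → x ≤ z → y ≤ z → x ∨ y ≤ z
  ∨-least {x} {y} {z} p q = proj₂ (proj₂ (supremum x y)) z p q

  +-monoˡ-≤ : ∀ {a b} c → a ≤ b → a + c ≤ b + c
  +-monoˡ-≤ {a} {b} c p = begin
    a + c           ≈⟨ +-cong p refl ⟩
    (a ∧ b) + c     ≈⟨ proj₂ +-distrib-∧ c a b ⟩
    (a + c) ∧ (b + c) ∎

  +-mono-≤ : ∀ {a b c d} → a ≤ b → c ≤ d → a + c ≤ b + d
  +-mono-≤ {a} {b} {c} {d} p q =
    ≤-trans (+-monoˡ-≤ c p)
      (≤-trans (≤-reflexive (+-comm b c))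
        (≤-trans (+-monoˡ-≤ b q) (≤-reflexive (+-comm d b))))

  1+1-1≈1 : (1# + 1#) + -1# ≈ 1#
  1+1-1≈1 = begin
    (1# + 1#) + -1#   ≈⟨ +-assoc 1# 1# -1# ⟩
    1# + (1# + -1#)   ≈⟨ +-cong refl (+-comm 1# -1#) ⟩
    1# + (-1# + 1#)   ≈⟨ +-cong refl -1+1≈0 ⟩
    1# + 0#           ≈⟨ +-identityʳ 1# ⟩
    1# ∎

  0+0≈0 : 0# + 0# ≈ 0#
  0+0≈0 = +-identityʳ 0#

  InUnit : Carrier → Set ℓ
  InUnit x = 0# ≤ x × x ≤ 1#

  U : Set (c ⊔ ℓ)
  U = Σ Carrier InUnit

  ⊕-closed : ∀ x y → InUnit x → InUnit y → InUnit ((x + y) ∧ 1#)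
  ⊕-closed x y (0≤x , _) (0≤y , _) =
    ∧-greatest (≤-trans (≤-reflexive (sym 0+0≈0)) (+-mono-≤ 0≤x 0≤y)) 0≤1 ,
    x∧y≤y (x + y) 1#

  ⊙-closed : ∀ x y → InUnit x → InUnit y → InUnit (((x + y) + -1#) ∨ 0#)
  ⊙-closed x y (_ , x≤1) (_ , y≤1) =
    y≤x∨y ((x + y) + -1#) 0# ,
    ∨-least (≤-trans (+-monoˡ-≤ -1# (+-mono-≤ x≤1 y≤1)) (≤-reflexive 1+1-1≈1)) 0≤1

  ∨-closed : ∀ x y → InUnit x → InUnit y → InUnit (x ∨ y)
  ∨-closed x y (0≤x , x≤1) (_ , y≤1) = ≤-trans 0≤x (x≤x∨y x y) , ∨-least x≤1 y≤1

  ∧-closed : ∀ x y → InUnit x → InUnit y → InUnit (x ∧ y)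
  ∧-closed x y (0≤x , x≤1) (0≤y , _) = ∧-greatest 0≤x 0≤y , ≤-trans (x∧y≤x x y) x≤1

  0-closed : InUnit 0#
  0-closed = ≤-refl , 0≤1

  1-closed : InUnit 1#
  1-closed = 0≤1 , ≤-refl

Γ : ∀ {c ℓ} → ULM c ℓ → RawMVM (c ⊔ ℓ) ℓ
Γ M = record
  { Carrier = U
  ; _≈_ = λ x y → proj₁ x ≈ proj₁ y
  ; isEquivalence = record
      { refl = refl ; sym = sym ; trans = trans }
  ; _⊕_ = λ { (x , p) (y , q) → (x + y) ∧ 1# , ⊕-closed x y p q }
  ; _⊙_ = λ { (x , p) (y , q) → ((x + y) + -1#) ∨ 0# , ⊙-closed x y p q }
  ; _∨_ = λ { (x , p) (y , q) → x ∨ y , ∨-closed x y p q }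
  ; _∧_ = λ { (x , p) (y , q) → x ∧ y , ∧-closed x y p q }
  ; 0# = 0# , 0-closed
  ; 1# = 1# , 1-closed
  }
  where open ULM M
        open ULMLemmas M

module _ {c₁ ℓ₁ c₂ ℓ₂} {M : ULM c₁ ℓ₁} {N : ULM c₂ ℓ₂} where
  private
    module M = ULM M
    module N = ULM N
    module LN = ULMLemmas N

  hom-mono : (f : ULMHom M N) → ∀ {x y} → x M.≤ y →
             ULMHom.⟦ f ⟧ x N.≤ ULMHom.⟦ f ⟧ y
  hom-mono f {x} {y} p = N.trans (ULMHom.cong f p) (ULMHom.∧-hom f x y)

  Γ-map : (f : ULMHom M N) → RawMVM.Carrier (Γ M) → RawMVM.Carrier (Γ N)
  Γ-map f (x , 0≤x , x≤1) =
    ULMHom.⟦ f ⟧ x ,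
    LN.≤-trans (LN.≤-reflexive (N.sym (ULMHom.0-hom f))) (hom-mono f 0≤x) ,
    LN.≤-trans (hom-mono f x≤1) (LN.≤-reflexive (ULMHom.1-hom f))

-- Fullness and faithfulness rest on the digits of an element y ≥ 0 of a unital lattice-ordered
-- monoid M: y = (y ∧ 1) + rest y with rest y = (y − 1) ∨ 0, and for clamp y = (y ∨ 0) ∧ 1 the pair
-- (clamp y, clamp (rest y)) is a good pair of Γ(M). Iterating, x + n = Σ_{i<2n} clamp (x + n − i)
-- whenever −n ≤ x ≤ n, and the strong unit provides such an n for every x. Hence a homomorphism is
-- determined by its restriction to Γ(M), and h : Γ(M) → Γ(N) extends by
-- F x = Σ_{i<2n} h (clamp (x + n − i)) − n. F is additive because h(u ⊕ e) + h(u ⊙ e) = h u + h e,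
-- and it preserves ∨ and ∧ because the digits of such an h-sum are the h-images of the digits.
--
-- For essential surjectivity we use Mundici's good sequences. Over an MV-monoidal algebra A, a
-- formal expression x₁ + ⋯ + xₖ − s is represented by a ℤ-indexed sequence that is 1 at negative
-- indices, eventually 0, and whose consecutive terms form good pairs: start from the sequence of 0,
-- add each xᵢ by f ↦ (j ↦ f j ⊕ (f (j − 1) ⊙ xᵢ)), and shift by s. Axioms (A4)–(A7) make these
-- additions commute and distribute over the pointwise lattice operations, which yields a unital
-- lattice-ordered monoid Ξ(A), and A is identified with Γ(Ξ(A)) through the one-term expressions.

module Submission where

open import Defs
open import Level using (Level)
open import Data.Product using (Σ; ∃; _×_; _,_; proj₁; proj₂)
import Data.Nat as ℕ
open import Data.Nat using (ℕ; zero; suc; z≤n; s≤s)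
import Data.Nat.Properties as ℕ
open import Data.Integer.Base using (ℤ; +_; -[1+_]; pred) renaming (suc to sucℤ)
open import Data.Integer.Properties using (pred-suc; suc-pred)
open import Data.List using (List; []; _∷_; _++_; length; foldr; replicate)
import Data.List.Properties as List
open import Data.List.Relation.Binary.Permutation.Propositional as ↭ using (_↭_)
import Data.List.Relation.Binary.Permutation.Propositional.Properties as Perm
open import Function using (flip)
open import Relation.Binary.Core using (Rel)
open import Relation.Binary.Bundles using (Setoid)
open import Relation.Binary.Structures using (IsEquivalence)
open import Relation.Binary.PropositionalEquality as ≡ using (_≡_)
open import Algebra.Core using (Op₂)
open import Algebra.Definitions using (_DistributesOver_; Congruent₂)
open import Algebra.Structures using (IsCommutativeMonoid)
open import Algebra.Bundles using (CommutativeMonoid)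
open import Algebra.Lattice.Bundles using (Lattice)
open import Algebra.Lattice.Structures using (IsDistributiveLattice)
open import Algebra.Lattice.Morphism.Structures using (IsLatticeMonomorphism)
import Algebra.Lattice.Morphism.LatticeMonomorphism as LatticeMonomorphism
import Algebra.Lattice.Properties.Lattice as LatticeProperties
import Algebra.Properties.CommutativeSemigroup as CommutativeSemigroupProperties
import Relation.Binary.Lattice as OrderTheoretic
import Relation.Binary.Lattice.Properties.JoinSemilattice as JoinSemilatticeProperties
import Relation.Binary.Lattice.Properties.MeetSemilattice as MeetSemilatticeProperties
import Relation.Binary.Reasoning.Setoid as SetoidReasoning

distrib-expand : ∀ {c ℓ} (S : Setoid c ℓ) (let open Setoid S) {_∘_ _⋆_ : Op₂ Carrier} →
                 Congruent₂ _≈_ _⋆_ → _DistributesOver_ _≈_ _∘_ _⋆_ →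
                 ∀ a b c d → (a ⋆ b) ∘ (c ⋆ d) ≈ ((a ∘ c) ⋆ (a ∘ d)) ⋆ ((b ∘ c) ⋆ (b ∘ d))
distrib-expand S ⋆-cong (distribˡ , distribʳ) a b c d =
  Setoid.trans S (distribʳ _ a b) (⋆-cong (distribˡ a c d) (distribˡ b c d))

pointwise-isDistributiveLattice : ∀ {i c ℓ} (I : Set i) {A : Set c} {_≈_ : A → A → Set ℓ}
  {_∨_ _∧_ : Op₂ A} → IsDistributiveLattice _≈_ _∨_ _∧_ →
  IsDistributiveLattice (λ (f g : I → A) → ∀ i → f i ≈ g i)
                        (λ f g i → f i ∨ g i) (λ f g i → f i ∧ g i)
pointwise-isDistributiveLattice I isDL = record
  { isLattice = record
    { isEquivalence = record
      { refl = λ i → refl ; sym = λ p i → sym (p i) ; trans = λ p q i → trans (p i) (q i) }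
    ; ∨-comm = λ f g i → ∨-comm (f i) (g i)
    ; ∨-assoc = λ f g h i → ∨-assoc (f i) (g i) (h i)
    ; ∨-cong = λ p q i → ∨-cong (p i) (q i)
    ; ∧-comm = λ f g i → ∧-comm (f i) (g i)
    ; ∧-assoc = λ f g h i → ∧-assoc (f i) (g i) (h i)
    ; ∧-cong = λ p q i → ∧-cong (p i) (q i)
    ; absorptive = (λ f g i → proj₁ absorptive (f i) (g i))
                 , (λ f g i → proj₂ absorptive (f i) (g i))
    }
  ; ∨-distrib-∧ = (λ f g h i → proj₁ ∨-distrib-∧ (f i) (g i) (h i))
                , (λ f g h i → proj₂ ∨-distrib-∧ (f i) (g i) (h i))
  ; ∧-distrib-∨ = (λ f g h i → proj₁ ∧-distrib-∨ (f i) (g i) (h i))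
                , (λ f g h i → proj₂ ∧-distrib-∨ (f i) (g i) (h i))
  }
  where open IsDistributiveLattice isDL

module LatticeOrder {c ℓ} (L : Lattice c ℓ) where
  open Lattice L
  open LatticeProperties L public using (∨-idem; ∧-idem)

  private
    order : OrderTheoretic.Lattice c ℓ ℓ
    order = LatticeProperties.∨-∧-orderTheoreticLattice L

  open OrderTheoretic.Lattice order public
    using (_≤_; x≤x∨y; y≤x∨y; ∨-least; x∧y≤x; x∧y≤y; ∧-greatest; antisym; ≤-respˡ-≈; ≤-respʳ-≈)
    renaming (refl to ≤-refl; reflexive to ≤-reflexive; trans to ≤-trans)
  open JoinSemilatticeProperties (OrderTheoretic.Lattice.joinSemilattice order) public
    using (∨-monotonic; x≤y⇒x∨y≈y)
  open MeetSemilatticeProperties (OrderTheoretic.Lattice.meetSemilattice order) public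
    using (∧-monotonic; y≤x⇒x∧y≈y)

  ∨-absorbs-middle : ∀ {a b c d} → b ≤ a ∨ d → c ≤ a ∨ d → (a ∨ b) ∨ (c ∨ d) ≈ a ∨ d
  ∨-absorbs-middle b≤ c≤ = antisym
    (∨-least (∨-least (x≤x∨y _ _) b≤) (∨-least c≤ (y≤x∨y _ _)))
    (∨-least (≤-trans (x≤x∨y _ _) (x≤x∨y _ _)) (≤-trans (y≤x∨y _ _) (y≤x∨y _ _)))

  ∧-absorbs-middle : ∀ {a b c d} → a ∧ d ≤ b → a ∧ d ≤ c → (a ∧ b) ∧ (c ∧ d) ≈ a ∧ d
  ∧-absorbs-middle ≤b ≤c = antisym
    (∧-greatest (≤-trans (x∧y≤x _ _) (x∧y≤x _ _)) (≤-trans (x∧y≤y _ _) (x∧y≤y _ _)))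
    (∧-greatest (∧-greatest (x∧y≤x _ _) ≤b) (∧-greatest ≤c (x∧y≤y _ _)))

  ∨-distribʳ-∨ : ∀ a b c → (a ∨ b) ∨ c ≈ (a ∨ c) ∨ (b ∨ c)
  ∨-distribʳ-∨ a b c = antisym
    (∨-least (∨-monotonic (x≤x∨y a c) (x≤x∨y b c)) (≤-trans (y≤x∨y b c) (y≤x∨y _ _)))
    (∨-least (∨-monotonic (x≤x∨y a b) ≤-refl) (∨-monotonic (y≤x∨y a b) ≤-refl))

  ∧-distribʳ-∧ : ∀ a b c → (a ∧ b) ∧ c ≈ (a ∧ c) ∧ (b ∧ c)
  ∧-distribʳ-∧ a b c = antisym
    (∧-greatest (∧-monotonic (x∧y≤x a b) ≤-refl) (∧-monotonic (x∧y≤y a b) ≤-refl))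
    (∧-greatest (∧-monotonic (x∧y≤x a c) (x∧y≤x b c)) (≤-trans (x∧y≤y _ _) (x∧y≤y b c)))

  module DistribMonotone {_∙_ : Op₂ Carrier} (∙-cong : Congruent₂ _≈_ _∙_)
                         (∙-distrib-∧ : _DistributesOver_ _≈_ _∙_ _∧_) where
    ∙-monoˡ-≤ : ∀ x {y z} → y ≤ z → y ∙ x ≤ z ∙ x
    ∙-monoˡ-≤ x y≤z = trans (∙-cong y≤z refl) (proj₂ ∙-distrib-∧ x _ _)

    ∙-monoʳ-≤ : ∀ x {y z} → y ≤ z → x ∙ y ≤ x ∙ z
    ∙-monoʳ-≤ x y≤z = trans (∙-cong refl y≤z) (proj₁ ∙-distrib-∧ x _ _)

    ∙-mono-≤ : ∀ {x x′ y y′} → x ≤ x′ → y ≤ y′ → x ∙ y ≤ x′ ∙ y′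
    ∙-mono-≤ {x′ = x′} {y = y} x≤x′ y≤y′ = ≤-trans (∙-monoˡ-≤ y x≤x′) (∙-monoʳ-≤ x′ y≤y′)

module MVMProperties {c ℓ} (A : MVM c ℓ) where
  open MVM A public
    using (Carrier; _≈_; _⊕_; _⊙_; _∨_; _∧_; 0#; 1#; A4; A5; A6; A7;
           ⊕-distrib-∨; ⊕-distrib-∧; ⊙-distrib-∨; ⊙-distrib-∧)
  open MVM A using (isDistributiveLattice; ⊕-isCommutativeMonoid; ⊙-isCommutativeMonoid)

  lattice : Lattice c ℓ
  lattice = record { isLattice = IsDistributiveLattice.isLattice isDistributiveLattice }

  open Lattice lattice public
    using (setoid; refl; sym; trans; ∨-comm; ∨-cong; ∨-congˡ; ∨-congʳ; ∧-comm; ∧-cong; ∧-congˡ; ∧-congʳ)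
  open LatticeOrder lattice public
  open IsCommutativeMonoid ⊕-isCommutativeMonoid public using () renaming
    (∙-cong to ⊕-cong; ∙-congˡ to ⊕-congˡ; ∙-congʳ to ⊕-congʳ; assoc to ⊕-assoc;
     comm to ⊕-comm; identityˡ to ⊕-identityˡ; identityʳ to ⊕-identityʳ)
  open IsCommutativeMonoid ⊙-isCommutativeMonoid public using () renaming
    (∙-cong to ⊙-cong; ∙-congˡ to ⊙-congˡ; ∙-congʳ to ⊙-congʳ; assoc to ⊙-assoc;
     comm to ⊙-comm; identityˡ to ⊙-identityˡ; identityʳ to ⊙-identityʳ)

  ⊕-commutativeMonoid : CommutativeMonoid c ℓ
  ⊕-commutativeMonoid = record { isCommutativeMonoid = ⊕-isCommutativeMonoid }
  open CommutativeSemigroupProperties (CommutativeMonoid.commutativeSemigroup ⊕-commutativeMonoid)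
    public using () renaming (interchange to ⊕-interchange)
  open DistribMonotone ⊕-cong ⊕-distrib-∧ public
    using () renaming (∙-monoʳ-≤ to ⊕-monoʳ-≤; ∙-mono-≤ to ⊕-mono-≤)
  open DistribMonotone ⊙-cong ⊙-distrib-∧ public
    renaming (∙-monoˡ-≤ to ⊙-monoˡ-≤; ∙-monoʳ-≤ to ⊙-monoʳ-≤; ∙-mono-≤ to ⊙-mono-≤)
  open SetoidReasoning setoid

  0≤x : ∀ x → 0# ≤ x
  0≤x x = ≤-respʳ-≈ (begin
    ((x ⊕ 1#) ⊙ ((x ⊙ 1#) ⊕ 0#)) ∨ 0# ≈⟨ A6 x 1# 0# ⟨
    (x ⊙ 1#) ⊕ 0#                      ≈⟨ ⊕-identityʳ _ ⟩
    x ⊙ 1#                             ≈⟨ ⊙-identityʳ x ⟩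
    x                                  ∎) (y≤x∨y _ 0#)

  x≤1 : ∀ x → x ≤ 1#
  x≤1 x = ≤-respˡ-≈ (begin
    ((x ⊙ 0#) ⊕ ((x ⊕ 0#) ⊙ 1#)) ∧ 1# ≈⟨ A7 x 0# 1# ⟨
    (x ⊕ 0#) ⊙ 1#                      ≈⟨ ⊙-identityʳ _ ⟩
    x ⊕ 0#                             ≈⟨ ⊕-identityʳ x ⟩
    x                                  ∎) (x∧y≤y _ 1#)

  x≤x⊕y : ∀ x y → x ≤ x ⊕ y
  x≤x⊕y x y = ≤-respˡ-≈ (⊕-identityʳ x) (⊕-monoʳ-≤ x (0≤x y))

  y≤x⊕y : ∀ x y → y ≤ x ⊕ y
  y≤x⊕y x y = ≤-respʳ-≈ (⊕-comm y x) (x≤x⊕y y x)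

  x⊙y≤x : ∀ x y → x ⊙ y ≤ x
  x⊙y≤x x y = ≤-respʳ-≈ (⊙-identityʳ x) (⊙-monoʳ-≤ x (x≤1 y))

  x⊙y≤y : ∀ x y → x ⊙ y ≤ y
  x⊙y≤y x y = ≤-respˡ-≈ (⊙-comm y x) (x⊙y≤x y x)

  ⊕-zeroˡ : ∀ x → 1# ⊕ x ≈ 1#
  ⊕-zeroˡ x = antisym (x≤1 _) (x≤x⊕y 1# x)

  ⊙-zeroˡ : ∀ x → 0# ⊙ x ≈ 0#
  ⊙-zeroˡ x = antisym (x⊙y≤x 0# x) (0≤x _)

  ⊙-zeroʳ : ∀ x → x ⊙ 0# ≈ 0#
  ⊙-zeroʳ x = trans (⊙-comm x 0#) (⊙-zeroˡ x)

  ∨-identityʳ : ∀ x → x ∨ 0# ≈ x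
  ∨-identityʳ x = trans (∨-comm x 0#) (x≤y⇒x∨y≈y (0≤x x))

  ∨-zeroʳ : ∀ x → x ∨ 1# ≈ 1#
  ∨-zeroʳ x = x≤y⇒x∨y≈y (x≤1 x)

  ∧-identityʳ : ∀ x → x ∧ 1# ≈ x
  ∧-identityʳ x = sym (x≤1 x)

  ∧-zeroʳ : ∀ x → x ∧ 0# ≈ 0#
  ∧-zeroʳ x = y≤x⇒x∧y≈y (0≤x x)

  infix 4 _≽_
  _≽_ : Rel Carrier ℓ
  p ≽ q = p ⊕ q ≈ p × p ⊙ q ≈ q

  ⊕≽⊙ : ∀ x y → x ⊕ y ≽ x ⊙ y
  ⊕≽⊙ x y = absorbs-⊕ , absorbs-⊙
    where
      absorbs-⊕ : (x ⊕ y) ⊕ (x ⊙ y) ≈ x ⊕ y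
      absorbs-⊕ = begin
        (x ⊕ y) ⊕ (x ⊙ y)         ≈⟨ ⊕-comm _ _ ⟩
        (x ⊙ y) ⊕ (x ⊕ y)         ≈⟨ ⊕-congˡ (⊙-identityʳ _) ⟨
        (x ⊙ y) ⊕ ((x ⊕ y) ⊙ 1#)  ≈⟨ A5 x y 1# ⟩
        (x ⊕ (y ⊙ 1#)) ⊙ (y ⊕ 1#) ≈⟨ ⊙-cong (⊕-congˡ (⊙-identityʳ y)) (trans (⊕-comm y 1#) (⊕-zeroˡ y)) ⟩
        (x ⊕ y) ⊙ 1#              ≈⟨ ⊙-identityʳ _ ⟩
        x ⊕ y                     ∎
      absorbs-⊙ : (x ⊕ y) ⊙ (x ⊙ y) ≈ x ⊙ y
      absorbs-⊙ = begin
        (x ⊕ y) ⊙ (x ⊙ y)         ≈⟨ ⊙-congˡ (⊕-identityʳ _) ⟨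
        (x ⊕ y) ⊙ ((x ⊙ y) ⊕ 0#)  ≈⟨ A4 x y 0# ⟩
        (x ⊙ (y ⊕ 0#)) ⊕ (y ⊙ 0#) ≈⟨ ⊕-cong (⊙-congˡ (⊕-identityʳ y)) (⊙-zeroʳ y) ⟩
        (x ⊙ y) ⊕ 0#              ≈⟨ ⊕-identityʳ _ ⟩
        x ⊙ y                     ∎

  ≽-trans : ∀ {a b d} → a ≽ b → b ≽ d → a ≽ d
  ≽-trans {a} {b} {d} (a⊕b , a⊙b) (b⊕d , b⊙d) =
    (begin
      a ⊕ d       ≈⟨ ⊕-congʳ a⊕b ⟨
      (a ⊕ b) ⊕ d ≈⟨ ⊕-assoc a b d ⟩
      a ⊕ (b ⊕ d) ≈⟨ ⊕-congˡ b⊕d ⟩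
      a ⊕ b       ≈⟨ a⊕b ⟩
      a           ∎) ,
    (begin
      a ⊙ d       ≈⟨ ⊙-congˡ b⊙d ⟨
      a ⊙ (b ⊙ d) ≈⟨ ⊙-assoc a b d ⟨
      (a ⊙ b) ⊙ d ≈⟨ ⊙-congʳ a⊙b ⟩
      b ⊙ d       ≈⟨ b⊙d ⟩
      d           ∎)

  1≽x : ∀ x → 1# ≽ x
  1≽x x = ⊕-zeroˡ x , ⊙-identityˡ x

  x≽0 : ∀ x → x ≽ 0#
  x≽0 x = ⊕-identityʳ x , ⊙-zeroʳ x

  ≽-resp-≈ : ∀ {a a′ b b′} → a ≈ a′ → b ≈ b′ → a ≽ b → a′ ≽ b′
  ≽-resp-≈ a≈ b≈ (a⊕b , a⊙b) = trans (⊕-cong (sym a≈) (sym b≈)) (trans a⊕b a≈)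
                             , trans (⊙-cong (sym a≈) (sym b≈)) (trans a⊙b b≈)

  ≽⇒≥ : ∀ {a b} → a ≽ b → b ≤ a
  ≽⇒≥ {a} {b} (_ , a⊙b) = ≤-respˡ-≈ a⊙b (x⊙y≤x a b)

  A5-≽ : ∀ {p q} → p ≽ q → ∀ z → q ⊕ (p ⊙ z) ≈ (p ⊕ (q ⊙ z)) ⊙ (q ⊕ z)
  A5-≽ {p} {q} (p⊕q , p⊙q) z = begin
    q ⊕ (p ⊙ z)               ≈⟨ ⊕-cong p⊙q (⊙-congʳ p⊕q) ⟨
    (p ⊙ q) ⊕ ((p ⊕ q) ⊙ z)   ≈⟨ A5 p q z ⟩
    (p ⊕ (q ⊙ z)) ⊙ (q ⊕ z)   ∎

  A6-≽ : ∀ {p q} → p ≽ q → ∀ z → q ⊕ z ≈ (p ⊙ (q ⊕ z)) ∨ z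
  A6-≽ {p} {q} (p⊕q , p⊙q) z = begin
    q ⊕ z                         ≈⟨ ⊕-congʳ p⊙q ⟨
    (p ⊙ q) ⊕ z                   ≈⟨ A6 p q z ⟩
    ((p ⊕ q) ⊙ ((p ⊙ q) ⊕ z)) ∨ z ≈⟨ ∨-congʳ (⊙-cong p⊕q (⊕-congʳ p⊙q)) ⟩
    (p ⊙ (q ⊕ z)) ∨ z             ∎

  A7-≽ : ∀ {p q} → p ≽ q → ∀ z → p ⊙ z ≈ (q ⊕ (p ⊙ z)) ∧ z
  A7-≽ {p} {q} (p⊕q , p⊙q) z = begin
    p ⊙ z                         ≈⟨ ⊙-congʳ p⊕q ⟨
    (p ⊕ q) ⊙ z                   ≈⟨ A7 p q z ⟩
    ((p ⊙ q) ⊕ ((p ⊕ q) ⊙ z)) ∧ z ≈⟨ ∧-congʳ (⊕-cong p⊙q (⊙-congʳ p⊕q)) ⟩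
    (q ⊕ (p ⊙ z)) ∧ z             ∎

  ≽-exchange : ∀ {p q} → p ≽ q → ∀ z → p ⊙ (q ⊕ z) ≈ q ⊕ (p ⊙ z)
  ≽-exchange {p} {q} p≽q z = antisym
    (≤-respʳ-≈ (sym (A5-≽ p≽q z)) (⊙-monoˡ-≤ (q ⊕ z) (x≤x⊕y p (q ⊙ z))))
    (≤-respˡ-≈ (sym (A6-≽ p≽q (p ⊙ z)))
      (∨-least (⊙-monoʳ-≤ p (⊕-monoʳ-≤ q (x⊙y≤y p z))) (⊙-monoʳ-≤ p (y≤x⊕y q z))))

  ≽-⊕-shift : ∀ {p q} → p ≽ q → ∀ w → p ⊕ w ≽ q ⊕ (p ⊙ w)
  ≽-⊕-shift {p} {q} (p⊕q , p⊙q) w =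
    (begin
      (p ⊕ w) ⊕ (q ⊕ (p ⊙ w)) ≈⟨ ⊕-interchange p w q _ ⟩
      (p ⊕ q) ⊕ (w ⊕ (p ⊙ w)) ≈⟨ ⊕-congʳ p⊕q ⟩
      p ⊕ (w ⊕ (p ⊙ w))       ≈⟨ ⊕-assoc p w _ ⟨
      (p ⊕ w) ⊕ (p ⊙ w)       ≈⟨ proj₁ (⊕≽⊙ p w) ⟩
      p ⊕ w                   ∎) ,
    (begin
      (p ⊕ w) ⊙ (q ⊕ (p ⊙ w)) ≈⟨ ⊙-comm _ _ ⟩
      (q ⊕ (p ⊙ w)) ⊙ (p ⊕ w) ≈⟨ A5 q p w ⟨
      (q ⊙ p) ⊕ ((q ⊕ p) ⊙ w) ≈⟨ ⊕-cong (trans (⊙-comm q p) p⊙q) (⊙-congʳ (trans (⊕-comm q p) p⊕q)) ⟩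
      q ⊕ (p ⊙ w)             ∎)

  ≽-⊙-absorbs : ∀ {r p} → r ≽ p → ∀ x → p ⊙ (r ⊙ x) ≈ p ⊙ x
  ≽-⊙-absorbs {r} {p} (_ , r⊙p) x = begin
    p ⊙ (r ⊙ x) ≈⟨ ⊙-assoc p r x ⟨
    (p ⊙ r) ⊙ x ≈⟨ ⊙-congʳ (trans (⊙-comm p r) r⊙p) ⟩
    p ⊙ x       ∎

  ≽-⊕⊙-symmetric : ∀ {r p} → r ≽ p → ∀ x y →
                   (p ⊙ x) ⊕ ((p ⊕ (r ⊙ x)) ⊙ y) ≈ (p ⊙ y) ⊕ ((p ⊕ (r ⊙ y)) ⊙ x)
  ≽-⊕⊙-symmetric {r} {p} r≽p x y = begin
    (p ⊙ x) ⊕ ((p ⊕ u) ⊙ y)  ≈⟨ ⊕-congʳ (≽-⊙-absorbs r≽p x) ⟨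
    (p ⊙ u) ⊕ ((p ⊕ u) ⊙ y)  ≈⟨ A5 p u y ⟩
    (p ⊕ (u ⊙ y)) ⊙ (u ⊕ y)  ≈⟨ ⊙-comm _ _ ⟩
    (u ⊕ y) ⊙ (p ⊕ (u ⊙ y))  ≈⟨ ⊙-congˡ (⊕-comm _ _) ⟩
    (u ⊕ y) ⊙ ((u ⊙ y) ⊕ p)  ≈⟨ A4 u y p ⟩
    (u ⊙ (y ⊕ p)) ⊕ (y ⊙ p)  ≈⟨ ⊕-cong u⊙[y⊕p]≈ (⊙-comm y p) ⟩
    ((p ⊕ (r ⊙ y)) ⊙ x) ⊕ (p ⊙ y) ≈⟨ ⊕-comm _ _ ⟩
    (p ⊙ y) ⊕ ((p ⊕ (r ⊙ y)) ⊙ x) ∎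
    where
      u = r ⊙ x
      u⊙[y⊕p]≈ : (r ⊙ x) ⊙ (y ⊕ p) ≈ (p ⊕ (r ⊙ y)) ⊙ x
      u⊙[y⊕p]≈ = begin
        (r ⊙ x) ⊙ (y ⊕ p) ≈⟨ ⊙-congʳ (⊙-comm r x) ⟩
        (x ⊙ r) ⊙ (y ⊕ p) ≈⟨ ⊙-assoc x r _ ⟩
        x ⊙ (r ⊙ (y ⊕ p)) ≈⟨ ⊙-congˡ (trans (⊙-congˡ (⊕-comm y p)) (≽-exchange r≽p y)) ⟩
        x ⊙ (p ⊕ (r ⊙ y)) ≈⟨ ⊙-comm _ _ ⟩
        (p ⊕ (r ⊙ y)) ⊙ x ∎

  mixed-≤-∨ : ∀ {p q} → p ≽ q → ∀ r s x → q ⊕ (r ⊙ x) ≤ (q ⊕ (p ⊙ x)) ∨ (s ⊕ (r ⊙ x))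
  mixed-≤-∨ {p} {q} p≽q r s x = ≤-respˡ-≈ (sym (A6-≽ p≽q (r ⊙ x)))
    (∨-monotonic (≤-trans (⊙-monoʳ-≤ p (⊕-monoʳ-≤ q (x⊙y≤y r x))) (≤-reflexive (≽-exchange p≽q x)))
                 (y≤x⊕y s (r ⊙ x)))

  ∧-≤-mixed : ∀ {r s} → r ≽ s → ∀ p q x → (q ⊕ (p ⊙ x)) ∧ (s ⊕ (r ⊙ x)) ≤ q ⊕ (r ⊙ x)
  ∧-≤-mixed {r} {s} r≽s p q x =
    ≤-respʳ-≈ (trans (sym (proj₁ ⊕-distrib-∧ q _ x)) (⊕-congˡ (sym (A7-≽ r≽s x))))
      (∧-greatest (≤-trans (x∧y≤y _ _) (y≤x⊕y q _))
                  (≤-trans (x∧y≤x _ _) (⊕-monoʳ-≤ q (x⊙y≤y p x))))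

  ∨-≽ : ∀ {a a′ b b′} → a ≽ a′ → b ≽ b′ → a ∨ b ≽ a′ ∨ b′
  ∨-≽ {a} {a′} {b} {b′} a≽a′ b≽b′ =
    trans (distrib-expand setoid ∨-cong ⊕-distrib-∨ a b a′ b′)
      (trans (∨-cong (∨-congʳ (proj₁ a≽a′)) (∨-congˡ (proj₁ b≽b′)))
             (∨-absorbs-middle a⊕b′≤ b⊕a′≤)) ,
    trans (distrib-expand setoid ∨-cong ⊙-distrib-∨ a b a′ b′)
      (trans (∨-cong (∨-congʳ (proj₂ a≽a′)) (∨-congˡ (proj₂ b≽b′)))
             (∨-absorbs-middle (≤-trans (x⊙y≤y a b′) (y≤x∨y a′ b′))
                               (≤-trans (x⊙y≤y b a′) (x≤x∨y a′ b′))))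
    where
      a⊕b′≤ : a ⊕ b′ ≤ a ∨ b
      a⊕b′≤ = ≤-respˡ-≈ (trans (sym (A6-≽ b≽b′ a)) (⊕-comm b′ a))
                (≤-respʳ-≈ (∨-comm b a) (∨-monotonic (x⊙y≤x b _) ≤-refl))
      b⊕a′≤ : b ⊕ a′ ≤ a ∨ b
      b⊕a′≤ = ≤-respˡ-≈ (trans (sym (A6-≽ a≽a′ b)) (⊕-comm a′ b))
                (∨-monotonic (x⊙y≤x a _) ≤-refl)

  ∧-≽ : ∀ {a a′ b b′} → a ≽ a′ → b ≽ b′ → a ∧ b ≽ a′ ∧ b′
  ∧-≽ {a} {a′} {b} {b′} a≽a′ b≽b′ =
    trans (distrib-expand setoid ∧-cong ⊕-distrib-∧ a b a′ b′)
      (trans (∧-cong (∧-congʳ (proj₁ a≽a′)) (∧-congˡ (proj₁ b≽b′)))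
             (∧-absorbs-middle (≤-trans (x∧y≤x a b) (x≤x⊕y a b′))
                               (≤-trans (x∧y≤y a b) (x≤x⊕y b a′)))) ,
    trans (distrib-expand setoid ∧-cong ⊙-distrib-∧ a b a′ b′)
      (trans (∧-cong (∧-congʳ (proj₂ a≽a′)) (∧-congˡ (proj₂ b≽b′)))
             (∧-absorbs-middle ≤a⊙b′ ≤b⊙a′))
    where
      ≤a⊙b′ : a′ ∧ b′ ≤ a ⊙ b′
      ≤a⊙b′ = ≤-respʳ-≈ (sym (A7-≽ a≽a′ b′)) (∧-monotonic (x≤x⊕y a′ _) ≤-refl)
      ≤b⊙a′ : a′ ∧ b′ ≤ b ⊙ a′
      ≤b⊙a′ = ≤-respʳ-≈ (sym (A7-≽ b≽b′ a′))
                (≤-respˡ-≈ (∧-comm b′ a′) (∧-monotonic (x≤x⊕y b′ _) ≤-refl))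

-- j +ⁿ n is j + n, by recursion on n so that j +ⁿ 0 reduces to j.
infixl 6 _+ⁿ_
_+ⁿ_ : ℤ → ℕ → ℤ
j +ⁿ zero  = j
j +ⁿ suc n = sucℤ (j +ⁿ n)

pred-+ⁿ : ∀ j n → pred (j +ⁿ n) ≡ pred j +ⁿ n
pred-+ⁿ j zero    = ≡.refl
pred-+ⁿ j (suc n) = begin
  pred (sucℤ (j +ⁿ n))  ≡⟨ pred-suc _ ⟩
  j +ⁿ n                ≡⟨ suc-pred _ ⟨
  sucℤ (pred (j +ⁿ n))  ≡⟨ ≡.cong sucℤ (pred-+ⁿ j n) ⟩
  sucℤ (pred j +ⁿ n)    ∎
  where open ≡.≡-Reasoning

+ⁿ-+ : ∀ j m n → j +ⁿ (m ℕ.+ n) ≡ j +ⁿ n +ⁿ m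
+ⁿ-+ j zero    n = ≡.refl
+ⁿ-+ j (suc m) n = ≡.cong sucℤ (+ⁿ-+ j m n)

module GoodSequences {c ℓ} (A : MVM c ℓ) where
  open MVMProperties A
  open SetoidReasoning setoid

  Seq : Set c
  Seq = ℤ → Carrier

  infix 4 _≋_ _≤ˢ_
  _≋_ : Rel Seq ℓ
  f ≋ g = ∀ j → f j ≈ g j

  _≤ˢ_ : Rel Seq ℓ
  f ≤ˢ g = ∀ j → f j ≤ g j

  _∨ˢ_ _∧ˢ_ : Seq → Seq → Seq
  (f ∨ˢ g) j = f j ∨ g j
  (f ∧ˢ g) j = f j ∧ g j

  Good : Seq → Set ℓ
  Good f = ∀ j → f (pred j) ≽ f j

  zeroˢ : Seq
  zeroˢ (+ n)      = 0#
  zeroˢ (-[1+ n ]) = 1#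

  -- If f is the good sequence of a, then f ⊞ x is the good sequence of a + x.
  infixl 6 _⊞_ _⊞⋆_
  _⊞_ : Seq → Carrier → Seq
  (f ⊞ x) j = f j ⊕ (f (pred j) ⊙ x)

  _⊞⋆_ : Seq → List Carrier → Seq
  f ⊞⋆ xs = foldr (flip _⊞_) f xs

  toSeq : List Carrier → Seq
  toSeq xs = zeroˢ ⊞⋆ xs

  shiftˢ : Seq → ℕ → Seq
  shiftˢ f s i = f (i +ⁿ s)

  ≡⇒≈ : ∀ {a b} → a ≡ b → a ≈ b
  ≡⇒≈ ≡.refl = refl

  ⊞-cong : ∀ {f g x y} → f ≋ g → x ≈ y → f ⊞ x ≋ g ⊞ y
  ⊞-cong f≋g x≈y j = ⊕-cong (f≋g j) (⊙-cong (f≋g (pred j)) x≈y)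

  ⊞-0# : ∀ f → f ⊞ 0# ≋ f
  ⊞-0# f j = trans (⊕-congˡ (⊙-zeroʳ _)) (⊕-identityʳ _)

  ⊞-distribˡ-∨ : ∀ f x y → f ⊞ (x ∨ y) ≋ (f ⊞ x) ∨ˢ (f ⊞ y)
  ⊞-distribˡ-∨ f x y j = trans (⊕-congˡ (proj₁ ⊙-distrib-∨ _ x y)) (proj₁ ⊕-distrib-∨ _ _ _)

  ⊞-distribˡ-∧ : ∀ f x y → f ⊞ (x ∧ y) ≋ (f ⊞ x) ∧ˢ (f ⊞ y)
  ⊞-distribˡ-∧ f x y j = trans (⊕-congˡ (proj₁ ⊙-distrib-∧ _ x y)) (proj₁ ⊕-distrib-∧ _ _ _)

  ⊞⋆-cong : ∀ xs {f g} → f ≋ g → f ⊞⋆ xs ≋ g ⊞⋆ xs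
  ⊞⋆-cong []       f≋g = f≋g
  ⊞⋆-cong (x ∷ xs) f≋g = ⊞-cong (⊞⋆-cong xs f≋g) refl

  ⊞⋆-++ : ∀ f xs ys → f ⊞⋆ (xs ++ ys) ≡ (f ⊞⋆ ys) ⊞⋆ xs
  ⊞⋆-++ f xs ys = List.foldr-++ (flip _⊞_) f xs ys

  Good-zeroˢ : Good zeroˢ
  Good-zeroˢ (+ zero)   = 1≽x 0#
  Good-zeroˢ (+ suc n)  = x≽0 0#
  Good-zeroˢ (-[1+ n ]) = 1≽x 1#

  Good-⊞ : ∀ {f} → Good f → ∀ x → Good (f ⊞ x)
  Good-⊞ {f} good-f x j = ≽-resp-≈ refl (⊕-congˡ (≽-⊙-absorbs (good-f (pred j)) x))
                                   (≽-⊕-shift (good-f j) (f (pred (pred j)) ⊙ x))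

  Good-⊞⋆ : ∀ xs {f} → Good f → Good (f ⊞⋆ xs)
  Good-⊞⋆ []       good-f = good-f
  Good-⊞⋆ (x ∷ xs) good-f = Good-⊞ (Good-⊞⋆ xs good-f) x

  Good-toSeq : ∀ xs → Good (toSeq xs)
  Good-toSeq xs = Good-⊞⋆ xs Good-zeroˢ

  Good-shiftˢ : ∀ {f} → Good f → ∀ s → Good (shiftˢ f s)
  Good-shiftˢ {f} good-f s j = ≽-resp-≈ (≡⇒≈ (≡.cong f (pred-+ⁿ j s))) refl (good-f (j +ⁿ s))

  ⊞-comm : ∀ {f} → Good f → ∀ x y → f ⊞ x ⊞ y ≋ f ⊞ y ⊞ x
  ⊞-comm {f} good-f x y j = begin
    (q ⊕ (p ⊙ x)) ⊕ ((p ⊕ (r ⊙ x)) ⊙ y) ≈⟨ ⊕-assoc q _ _ ⟩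
    q ⊕ ((p ⊙ x) ⊕ ((p ⊕ (r ⊙ x)) ⊙ y)) ≈⟨ ⊕-congˡ (≽-⊕⊙-symmetric (good-f (pred j)) x y) ⟩
    q ⊕ ((p ⊙ y) ⊕ ((p ⊕ (r ⊙ y)) ⊙ x)) ≈⟨ ⊕-assoc q _ _ ⟨
    (q ⊕ (p ⊙ y)) ⊕ ((p ⊕ (r ⊙ y)) ⊙ x) ∎
    where
      r = f (pred (pred j))
      p = f (pred j)
      q = f j

  ⊞⋆-↭ : ∀ {f} → Good f → ∀ {xs ys} → xs ↭ ys → f ⊞⋆ xs ≋ f ⊞⋆ ys
  ⊞⋆-↭ good-f ↭.refl                 = λ j → refl
  ⊞⋆-↭ good-f (↭.prep x xs↭ys)       = ⊞-cong (⊞⋆-↭ good-f xs↭ys) refl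
  ⊞⋆-↭ good-f (↭.swap {ys = ys} x y xs↭ys) j = trans
    (⊞-cong (⊞-cong (⊞⋆-↭ good-f xs↭ys) refl) refl j)
    (⊞-comm (Good-⊞⋆ ys good-f) y x j)
  ⊞⋆-↭ good-f (↭.trans xs↭ys ys↭zs) j = trans (⊞⋆-↭ good-f xs↭ys j) (⊞⋆-↭ good-f ys↭zs j)

  Good-∨ˢ : ∀ {f g} → Good f → Good g → Good (f ∨ˢ g)
  Good-∨ˢ good-f good-g j = ∨-≽ (good-f j) (good-g j)

  Good-∧ˢ : ∀ {f g} → Good f → Good g → Good (f ∧ˢ g)
  Good-∧ˢ good-f good-g j = ∧-≽ (good-f j) (good-g j)

  ⊞-distrib-∨ˢ : ∀ {f g} → Good f → Good g → ∀ x → (f ∨ˢ g) ⊞ x ≋ (f ⊞ x) ∨ˢ (g ⊞ x)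
  ⊞-distrib-∨ˢ {f} {g} good-f good-g x j = begin
    (q ∨ s) ⊕ ((p ∨ r) ⊙ x)        ≈⟨ ⊕-congˡ (proj₂ ⊙-distrib-∨ x p r) ⟩
    (q ∨ s) ⊕ ((p ⊙ x) ∨ (r ⊙ x))  ≈⟨ distrib-expand setoid ∨-cong ⊕-distrib-∨ q s _ _ ⟩
    ((q ⊕ (p ⊙ x)) ∨ (q ⊕ (r ⊙ x))) ∨ ((s ⊕ (p ⊙ x)) ∨ (s ⊕ (r ⊙ x)))
      ≈⟨ ∨-absorbs-middle (mixed-≤-∨ (good-f j) r s x)
                          (≤-respʳ-≈ (∨-comm _ _) (mixed-≤-∨ (good-g j) p q x)) ⟩
    (q ⊕ (p ⊙ x)) ∨ (s ⊕ (r ⊙ x))  ∎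
    where
      p = f (pred j)
      q = f j
      r = g (pred j)
      s = g j

  ⊞-distrib-∧ˢ : ∀ {f g} → Good f → Good g → ∀ x → (f ∧ˢ g) ⊞ x ≋ (f ⊞ x) ∧ˢ (g ⊞ x)
  ⊞-distrib-∧ˢ {f} {g} good-f good-g x j = begin
    (q ∧ s) ⊕ ((p ∧ r) ⊙ x)        ≈⟨ ⊕-congˡ (proj₂ ⊙-distrib-∧ x p r) ⟩
    (q ∧ s) ⊕ ((p ⊙ x) ∧ (r ⊙ x))  ≈⟨ distrib-expand setoid ∧-cong ⊕-distrib-∧ q s _ _ ⟩
    ((q ⊕ (p ⊙ x)) ∧ (q ⊕ (r ⊙ x))) ∧ ((s ⊕ (p ⊙ x)) ∧ (s ⊕ (r ⊙ x)))
      ≈⟨ ∧-absorbs-middle (∧-≤-mixed (good-g j) p q x)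
                          (≤-respˡ-≈ (∧-comm _ _) (∧-≤-mixed (good-f j) r s x)) ⟩
    (q ⊕ (p ⊙ x)) ∧ (s ⊕ (r ⊙ x))  ∎
    where
      p = f (pred j)
      q = f j
      r = g (pred j)
      s = g j

  ⊞⋆-distrib-∨ˢ : ∀ xs {f g} → Good f → Good g → (f ∨ˢ g) ⊞⋆ xs ≋ (f ⊞⋆ xs) ∨ˢ (g ⊞⋆ xs)
  ⊞⋆-distrib-∨ˢ []       good-f good-g j = refl
  ⊞⋆-distrib-∨ˢ (x ∷ xs) good-f good-g j = trans
    (⊞-cong (⊞⋆-distrib-∨ˢ xs good-f good-g) refl j)
    (⊞-distrib-∨ˢ (Good-⊞⋆ xs good-f) (Good-⊞⋆ xs good-g) x j)

  ⊞⋆-distrib-∧ˢ : ∀ xs {f g} → Good f → Good g → (f ∧ˢ g) ⊞⋆ xs ≋ (f ⊞⋆ xs) ∧ˢ (g ⊞⋆ xs)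
  ⊞⋆-distrib-∧ˢ []       good-f good-g j = refl
  ⊞⋆-distrib-∧ˢ (x ∷ xs) good-f good-g j = trans
    (⊞-cong (⊞⋆-distrib-∧ˢ xs good-f good-g) refl j)
    (⊞-distrib-∧ˢ (Good-⊞⋆ xs good-f) (Good-⊞⋆ xs good-g) x j)

  ⊞⋆-shiftˢ : ∀ xs f s j → (f ⊞⋆ xs) (j +ⁿ s) ≈ (shiftˢ f s ⊞⋆ xs) j
  ⊞⋆-shiftˢ []       f s j = refl
  ⊞⋆-shiftˢ (x ∷ xs) f s j = trans
    (⊕-congˡ (⊙-congʳ (≡⇒≈ (≡.cong (f ⊞⋆ xs) (pred-+ⁿ j s)))))
    (⊞-cong (⊞⋆-shiftˢ xs f s) refl j)

  ⊞-1# : ∀ {f} → Good f → ∀ j → (f ⊞ 1#) j ≈ f (pred j)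
  ⊞-1# {f} good-f j = begin
    f j ⊕ (f (pred j) ⊙ 1#) ≈⟨ ⊕-congˡ (⊙-identityʳ _) ⟩
    f j ⊕ f (pred j)        ≈⟨ ⊕-comm _ _ ⟩
    f (pred j) ⊕ f j        ≈⟨ proj₁ (good-f j) ⟩
    f (pred j)              ∎

  ⊞⋆-replicate-1# : ∀ {f} → Good f → ∀ t j → (f ⊞⋆ replicate t 1#) (j +ⁿ t) ≈ f j
  ⊞⋆-replicate-1# good-f zero    j = refl
  ⊞⋆-replicate-1# {f} good-f (suc t) j = begin
    (f ⊞⋆ replicate t 1# ⊞ 1#) (sucℤ (j +ⁿ t)) ≈⟨ ⊞-1# (Good-⊞⋆ (replicate t 1#) good-f) _ ⟩
    (f ⊞⋆ replicate t 1#) (pred (sucℤ (j +ⁿ t))) ≡⟨ ≡.cong (f ⊞⋆ replicate t 1#) (pred-suc _) ⟩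
    (f ⊞⋆ replicate t 1#) (j +ⁿ t)              ≈⟨ ⊞⋆-replicate-1# good-f t j ⟩
    f j                                         ∎

  toSeq-negative : ∀ xs n → toSeq xs -[1+ n ] ≈ 1#
  toSeq-negative []       n = refl
  toSeq-negative (x ∷ xs) n = trans (⊕-congʳ (toSeq-negative xs n)) (⊕-zeroˡ _)

  toSeq-vanishes : ∀ xs n → length xs ℕ.≤ n → toSeq xs (+ n) ≈ 0#
  toSeq-vanishes []       n       _           = refl
  toSeq-vanishes (x ∷ xs) (suc n) (s≤s |xs|≤n) = begin
    toSeq xs (+ suc n) ⊕ (toSeq xs (+ n) ⊙ x)
      ≈⟨ ⊕-cong (toSeq-vanishes xs (suc n) (ℕ.m≤n⇒m≤1+n |xs|≤n)) (⊙-congʳ (toSeq-vanishes xs n |xs|≤n)) ⟩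
    0# ⊕ (0# ⊙ x) ≈⟨ ⊕-identityˡ _ ⟩
    0# ⊙ x        ≈⟨ ⊙-zeroˡ x ⟩
    0#            ∎

  ⊞-mono : ∀ {f g x y} → f ≤ˢ g → x ≤ y → f ⊞ x ≤ˢ g ⊞ y
  ⊞-mono f≤g x≤y j = ⊕-mono-≤ (f≤g j) (⊙-mono-≤ (f≤g (pred j)) x≤y)

  ⊞⋆-inflationary : ∀ xs f → f ≤ˢ f ⊞⋆ xs
  ⊞⋆-inflationary []       f j = ≤-refl
  ⊞⋆-inflationary (x ∷ xs) f j = ≤-trans (⊞⋆-inflationary xs f j) (x≤x⊕y _ _)

  Good-antitone : ∀ {f} → Good f → ∀ j n → f (j +ⁿ n) ≤ f j
  Good-antitone good-f j zero    = ≤-refl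
  Good-antitone {f} good-f j (suc n) = ≤-trans
    (≤-respʳ-≈ (≡⇒≈ (≡.cong f (pred-suc (j +ⁿ n)))) (≽⇒≥ (good-f (sucℤ (j +ⁿ n)))))
    (Good-antitone good-f j n)

  tailˢ : Seq → Seq
  tailˢ g (+ n)      = g (+ suc n)
  tailˢ g (-[1+ n ]) = 1#

  digits : Seq → ℕ → List Carrier
  digits g zero    = []
  digits g (suc L) = g (+ 0) ∷ digits (tailˢ g) L

  Good-tailˢ : ∀ {g} → Good g → Good (tailˢ g)
  Good-tailˢ good-g (+ zero)   = 1≽x _
  Good-tailˢ good-g (+ suc n)  = good-g (+ suc (suc n))
  Good-tailˢ good-g (-[1+ n ]) = 1≽x _

  Good-head≽ : ∀ {g} → Good g → ∀ n → g (+ 0) ≽ g (+ suc n)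
  Good-head≽ good-g zero    = good-g (+ 1)
  Good-head≽ good-g (suc n) = ≽-trans (Good-head≽ good-g n) (good-g (+ suc (suc n)))

  tailˢ⊞head : ∀ {g} → Good g → (∀ n → g -[1+ n ] ≈ 1#) → tailˢ g ⊞ g (+ 0) ≋ g
  tailˢ⊞head {g} good-g negative (+ zero) = begin
    g (+ 1) ⊕ (1# ⊙ g (+ 0)) ≈⟨ ⊕-congˡ (⊙-identityˡ _) ⟩
    g (+ 1) ⊕ g (+ 0)        ≈⟨ ⊕-comm _ _ ⟩
    g (+ 0) ⊕ g (+ 1)        ≈⟨ proj₁ (good-g (+ 1)) ⟩
    g (+ 0)                  ∎
  tailˢ⊞head {g} good-g negative (+ suc n) = begin
    g (+ suc (suc n)) ⊕ (g (+ suc n) ⊙ g (+ 0))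
      ≈⟨ ⊕-congˡ (trans (⊙-comm _ _) (proj₂ (Good-head≽ good-g n))) ⟩
    g (+ suc (suc n)) ⊕ g (+ suc n) ≈⟨ ⊕-comm _ _ ⟩
    g (+ suc n) ⊕ g (+ suc (suc n)) ≈⟨ proj₁ (good-g (+ suc (suc n))) ⟩
    g (+ suc n)                     ∎
  tailˢ⊞head good-g negative -[1+ n ] = trans (⊕-zeroˡ _) (sym (negative n))

  toSeq-digits : ∀ L g → Good g → (∀ n → g -[1+ n ] ≈ 1#) → (∀ n → L ℕ.≤ n → g (+ n) ≈ 0#) →
                 toSeq (digits g L) ≋ g
  toSeq-digits zero    g good-g negative vanishes (+ n)      = sym (vanishes n z≤n)
  toSeq-digits zero    g good-g negative vanishes -[1+ n ]   = sym (negative n)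
  toSeq-digits (suc L) g good-g negative vanishes j = trans
    (⊞-cong (toSeq-digits L (tailˢ g) (Good-tailˢ good-g) (λ _ → refl)
                          (λ n L≤n → vanishes (suc n) (s≤s L≤n))) refl j)
    (tailˢ⊞head good-g negative j)

module _ {c₁ ℓ₁ c₂ ℓ₂} {A : RawMVM c₁ ℓ₁} (M : ULM c₂ ℓ₂) where
  private
    module A = RawMVM A
    module ΓM = RawMVM (Γ M)
    module M = ULM M
    module ≈ᴬ = IsEquivalence A.isEquivalence

  Γ-iso-from-inverse : (f : MVMHom A (Γ M)) (g : ΓM.Carrier → A.Carrier) →
                       (∀ {x y} → x ΓM.≈ y → g x A.≈ g y) →
                       (∀ x → g (MVMHom.⟦ f ⟧ x) A.≈ x) → (∀ y → MVMHom.⟦ f ⟧ (g y) ΓM.≈ y) →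
                       MVMIso (Γ M) A
  Γ-iso-from-inverse f g g-cong g∘f f∘g = record
    { to = record
      { ⟦_⟧ = g ; cong = g-cong
      ; ⊕-hom = preserved (λ p q → M.∧-cong (M.+-cong p q) M.refl) f.⊕-hom
      ; ⊙-hom = preserved (λ p q → M.∨-cong (M.+-cong (M.+-cong p q) M.refl) M.refl) f.⊙-hom
      ; ∨-hom = preserved M.∨-cong f.∨-hom
      ; ∧-hom = preserved M.∧-cong f.∧-hom
      ; 0-hom = ≈ᴬ.trans (g-cong (M.sym f.0-hom)) (g∘f A.0#)
      ; 1-hom = ≈ᴬ.trans (g-cong (M.sym f.1-hom)) (g∘f A.1#)
      }
    ; from = f ; from∘to = f∘g ; to∘from = g∘f
    }
    where
      module f = MVMHom f
      preserved : ∀ {_∙ᴬ_ : Op₂ A.Carrier} {_∙_ : Op₂ ΓM.Carrier} →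
                  (∀ {x x′ y y′} → x ΓM.≈ x′ → y ΓM.≈ y′ → (x ∙ y) ΓM.≈ (x′ ∙ y′)) →
                  (∀ a b → f.⟦ a ∙ᴬ b ⟧ ΓM.≈ (f.⟦ a ⟧ ∙ f.⟦ b ⟧)) →
                  ∀ x y → g (x ∙ y) A.≈ (g x ∙ᴬ g y)
      preserved {_∙ᴬ_} {_∙_} ∙-cong ∙-hom x y = ≈ᴬ.trans
        (g-cong {x ∙ y} {f.⟦ g x ∙ᴬ g y ⟧}
          (M.trans (∙-cong {x} {f.⟦ g x ⟧} {y} {f.⟦ g y ⟧} (M.sym (f∘g x)) (M.sym (f∘g y)))
                   (M.sym (∙-hom (g x) (g y)))))
        (g∘f _)

module Ξ {c ℓ} (A : MVM c ℓ) where
  open MVMProperties A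
  open GoodSequences A
  open SetoidReasoning setoid

  -- (xs , s) stands for x₁ + ⋯ + xₖ − s; terms are identified when their good sequences agree.
  Term : Set c
  Term = List Carrier × ℕ

  ⟦_⟧ : Term → Seq
  ⟦ xs , s ⟧ j = toSeq xs (j +ⁿ s)

  infix 4 _≈ᵀ_
  _≈ᵀ_ : Rel Term ℓ
  X ≈ᵀ Y = ⟦ X ⟧ ≋ ⟦ Y ⟧

  infixl 6 _+ᵀ_
  _+ᵀ_ : Op₂ Term
  (xs , s) +ᵀ (ys , t) = xs ++ ys , s ℕ.+ t

  0ᵀ 1ᵀ -1ᵀ : Term
  0ᵀ  = [] , 0
  1ᵀ  = 1# ∷ [] , 0
  -1ᵀ = [] , 1

  -- Both arguments are first brought to the common shift t + s by adding t, resp. s, copies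
  -- of 1; the pointwise combination of the two sequences is then read back off its digits.
  lift₂ : Op₂ Carrier → Op₂ Term
  lift₂ _⋆_ (xs , s) (ys , t) =
    digits (λ i → toSeq (replicate t 1# ++ xs) i ⋆ toSeq (replicate s 1# ++ ys) i)
           (length (replicate t 1# ++ xs) ℕ.+ length (replicate s 1# ++ ys)) ,
    t ℕ.+ s

  infixr 6 _∨ᵀ_
  infixr 7 _∧ᵀ_
  _∨ᵀ_ _∧ᵀ_ : Op₂ Term
  _∨ᵀ_ = lift₂ _∨_
  _∧ᵀ_ = lift₂ _∧_

  Good-⟦⟧ : ∀ X → Good ⟦ X ⟧
  Good-⟦⟧ (xs , s) = Good-shiftˢ (Good-toSeq xs) s

  toSeq-pad : ∀ xs s t j → toSeq (replicate t 1# ++ xs) (j +ⁿ (t ℕ.+ s)) ≈ toSeq xs (j +ⁿ s)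
  toSeq-pad xs s t j = begin
    toSeq (replicate t 1# ++ xs) (j +ⁿ (t ℕ.+ s))
      ≡⟨ ≡.cong₂ (λ f i → f i) (⊞⋆-++ zeroˢ (replicate t 1#) xs) (+ⁿ-+ j t s) ⟩
    (toSeq xs ⊞⋆ replicate t 1#) (j +ⁿ s +ⁿ t)
      ≈⟨ ⊞⋆-replicate-1# (Good-toSeq xs) t (j +ⁿ s) ⟩
    toSeq xs (j +ⁿ s)
      ∎

  module Lifted (_⋆_ : Op₂ Carrier) (⋆-cong : Congruent₂ _≈_ _⋆_)
                (Good-⋆ : ∀ {f g} → Good f → Good g → Good (λ i → f i ⋆ g i))
                (1⋆1 : 1# ⋆ 1# ≈ 1#) (0⋆0 : 0# ⋆ 0# ≈ 0#) where

    ⟦⟧-lift₂ : ∀ X Y → ⟦ lift₂ _⋆_ X Y ⟧ ≋ (λ j → ⟦ X ⟧ j ⋆ ⟦ Y ⟧ j)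
    ⟦⟧-lift₂ (xs , s) (ys , t) j = begin
        toSeq (digits h L) (j +ⁿ (t ℕ.+ s)) ≈⟨ toSeq-digits L h good-h negative vanishes _ ⟩
        h (j +ⁿ (t ℕ.+ s))                  ≈⟨ ⋆-cong (toSeq-pad xs s t j) ys-pad ⟩
        toSeq xs (j +ⁿ s) ⋆ toSeq ys (j +ⁿ t) ∎
      where
        xs′ = replicate t 1# ++ xs
        ys′ = replicate s 1# ++ ys
        h : Seq
        h i = toSeq xs′ i ⋆ toSeq ys′ i
        L = length xs′ ℕ.+ length ys′
        good-h : Good h
        good-h = Good-⋆ (Good-toSeq xs′) (Good-toSeq ys′)
        negative : ∀ n → h -[1+ n ] ≈ 1#
        negative n = trans (⋆-cong (toSeq-negative xs′ n) (toSeq-negative ys′ n)) 1⋆1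
        vanishes : ∀ n → L ℕ.≤ n → h (+ n) ≈ 0#
        vanishes n L≤n = trans (⋆-cong (toSeq-vanishes xs′ n (ℕ.m+n≤o⇒m≤o (length xs′) L≤n))
                                       (toSeq-vanishes ys′ n (ℕ.m+n≤o⇒n≤o (length xs′) L≤n))) 0⋆0
        ys-pad : toSeq ys′ (j +ⁿ (t ℕ.+ s)) ≈ toSeq ys (j +ⁿ t)
        ys-pad = trans (≡⇒≈ (≡.cong (λ k → toSeq ys′ (j +ⁿ k)) (ℕ.+-comm t s))) (toSeq-pad ys t s j)

  open Lifted _∨_ ∨-cong Good-∨ˢ (∨-idem 1#) (∨-idem 0#) renaming (⟦⟧-lift₂ to ⟦⟧-∨)
  open Lifted _∧_ ∧-cong Good-∧ˢ (∧-idem 1#) (∧-idem 0#) renaming (⟦⟧-lift₂ to ⟦⟧-∧)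

  ⟦⟧-isLatticeMonomorphism :
    IsLatticeMonomorphism (record { _≈_ = _≈ᵀ_ ; _∨_ = _∨ᵀ_ ; _∧_ = _∧ᵀ_ })
                          (record { _≈_ = _≋_ ; _∨_ = _∨ˢ_ ; _∧_ = _∧ˢ_ }) ⟦_⟧
  ⟦⟧-isLatticeMonomorphism = record
    { isLatticeHomomorphism = record
      { isRelHomomorphism = record { cong = λ X≈Y → X≈Y }
      ; ∧-homo = ⟦⟧-∧
      ; ∨-homo = ⟦⟧-∨
      }
    ; injective = λ X≈Y → X≈Y
    }

  isDistributiveLattice : IsDistributiveLattice _≈ᵀ_ _∨ᵀ_ _∧ᵀ_
  isDistributiveLattice = LatticeMonomorphism.isDistributiveLattice ⟦⟧-isLatticeMonomorphism
    (pointwise-isDistributiveLattice ℤ (MVM.isDistributiveLattice A))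

  open IsDistributiveLattice isDistributiveLattice public
    using () renaming (isEquivalence to ≈ᵀ-isEquivalence; ∨-cong to ∨ᵀ-cong; ∧-cong to ∧ᵀ-cong)

  ⟦⟧-+ : ∀ X Y j → ⟦ X +ᵀ Y ⟧ j ≈ (⟦ Y ⟧ ⊞⋆ proj₁ X) (j +ⁿ proj₂ X)
  ⟦⟧-+ (xs , s) (ys , t) j = begin
    toSeq (xs ++ ys) (j +ⁿ (s ℕ.+ t))    ≡⟨ ≡.cong₂ (λ f i → f i) (⊞⋆-++ zeroˢ xs ys) shifts ⟩
    (toSeq ys ⊞⋆ xs) (j +ⁿ s +ⁿ t)       ≈⟨ ⊞⋆-shiftˢ xs (toSeq ys) t (j +ⁿ s) ⟩
    (⟦ ys , t ⟧ ⊞⋆ xs) (j +ⁿ s)          ∎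
    where
      shifts : j +ⁿ (s ℕ.+ t) ≡ j +ⁿ s +ⁿ t
      shifts = ≡.trans (≡.cong (j +ⁿ_) (ℕ.+-comm s t)) (+ⁿ-+ j t s)

  +ᵀ-comm : ∀ X Y → X +ᵀ Y ≈ᵀ Y +ᵀ X
  +ᵀ-comm (xs , s) (ys , t) j = begin
    toSeq (xs ++ ys) (j +ⁿ (s ℕ.+ t)) ≈⟨ ⊞⋆-↭ Good-zeroˢ (Perm.++-comm xs ys) _ ⟩
    toSeq (ys ++ xs) (j +ⁿ (s ℕ.+ t)) ≡⟨ ≡.cong (λ k → toSeq (ys ++ xs) (j +ⁿ k)) (ℕ.+-comm s t) ⟩
    toSeq (ys ++ xs) (j +ⁿ (t ℕ.+ s)) ∎

  +ᵀ-congˡ : ∀ X {Y Y′} → Y ≈ᵀ Y′ → X +ᵀ Y ≈ᵀ X +ᵀ Y′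
  +ᵀ-congˡ X {Y} {Y′} Y≈Y′ j = begin
    ⟦ X +ᵀ Y ⟧ j                             ≈⟨ ⟦⟧-+ X Y j ⟩
    (⟦ Y ⟧ ⊞⋆ proj₁ X) (j +ⁿ proj₂ X)        ≈⟨ ⊞⋆-cong (proj₁ X) Y≈Y′ _ ⟩
    (⟦ Y′ ⟧ ⊞⋆ proj₁ X) (j +ⁿ proj₂ X)       ≈⟨ ⟦⟧-+ X Y′ j ⟨
    ⟦ X +ᵀ Y′ ⟧ j                            ∎

  +ᵀ-cong : Congruent₂ _≈ᵀ_ _+ᵀ_
  +ᵀ-cong {X} {X′} {Y} {Y′} X≈X′ Y≈Y′ j = begin
    ⟦ X +ᵀ Y ⟧ j   ≈⟨ +ᵀ-congˡ X Y≈Y′ j ⟩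
    ⟦ X +ᵀ Y′ ⟧ j  ≈⟨ +ᵀ-comm X Y′ j ⟩
    ⟦ Y′ +ᵀ X ⟧ j  ≈⟨ +ᵀ-congˡ Y′ X≈X′ j ⟩
    ⟦ Y′ +ᵀ X′ ⟧ j ≈⟨ +ᵀ-comm Y′ X′ j ⟩
    ⟦ X′ +ᵀ Y′ ⟧ j ∎

  +ᵀ-isCommutativeMonoid : IsCommutativeMonoid _≈ᵀ_ _+ᵀ_ 0ᵀ
  +ᵀ-isCommutativeMonoid = record
    { isMonoid = record
      { isSemigroup = record
        -- _≈ᵀ_ unfolds to a Π-type, so Agda cannot infer the implicit arguments of +ᵀ-cong.
        { isMagma = record { isEquivalence = ≈ᵀ-isEquivalence
                           ; ∙-cong = λ {X X′ Y Y′} → +ᵀ-cong {X} {X′} {Y} {Y′} }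
        ; assoc = λ { (xs , s) (ys , t) (zs , u) j →
            ≡⇒≈ (≡.cong₂ (λ l k → toSeq l (j +ⁿ k)) (List.++-assoc xs ys zs) (ℕ.+-assoc s t u)) }
        }
      ; identity = (λ X j → refl)
                 , (λ { (xs , s) j →
                     ≡⇒≈ (≡.cong₂ (λ l k → toSeq l (j +ⁿ k)) (List.++-identityʳ xs) (ℕ.+-identityʳ s)) })
      }
    ; comm = +ᵀ-comm
    }

  module Distrib (_⋆_ : Op₂ Carrier) (_⋆ᵀ_ : Op₂ Term) (⋆ᵀ-cong : Congruent₂ _≈ᵀ_ _⋆ᵀ_)
                 (⟦⟧-⋆ : ∀ X Y → ⟦ X ⋆ᵀ Y ⟧ ≋ (λ j → ⟦ X ⟧ j ⋆ ⟦ Y ⟧ j))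
                 (⊞⋆-distrib-⋆ : ∀ xs {f g} → Good f → Good g →
                                 (λ j → f j ⋆ g j) ⊞⋆ xs ≋ (λ j → (f ⊞⋆ xs) j ⋆ (g ⊞⋆ xs) j))
                 (⋆-cong : Congruent₂ _≈_ _⋆_) where

    +ᵀ-distribˡ : ∀ X Y Z → X +ᵀ (Y ⋆ᵀ Z) ≈ᵀ (X +ᵀ Y) ⋆ᵀ (X +ᵀ Z)
    +ᵀ-distribˡ X@(xs , s) Y Z j = begin
      ⟦ X +ᵀ (Y ⋆ᵀ Z) ⟧ j                             ≈⟨ ⟦⟧-+ X (Y ⋆ᵀ Z) j ⟩
      (⟦ Y ⋆ᵀ Z ⟧ ⊞⋆ xs) (j +ⁿ s)                     ≈⟨ ⊞⋆-cong xs (⟦⟧-⋆ Y Z) _ ⟩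
      ((λ i → ⟦ Y ⟧ i ⋆ ⟦ Z ⟧ i) ⊞⋆ xs) (j +ⁿ s)      ≈⟨ ⊞⋆-distrib-⋆ xs (Good-⟦⟧ Y) (Good-⟦⟧ Z) _ ⟩
      (⟦ Y ⟧ ⊞⋆ xs) (j +ⁿ s) ⋆ (⟦ Z ⟧ ⊞⋆ xs) (j +ⁿ s) ≈⟨ ⋆-cong (⟦⟧-+ X Y j) (⟦⟧-+ X Z j) ⟨
      ⟦ X +ᵀ Y ⟧ j ⋆ ⟦ X +ᵀ Z ⟧ j                     ≈⟨ ⟦⟧-⋆ (X +ᵀ Y) (X +ᵀ Z) j ⟨
      ⟦ (X +ᵀ Y) ⋆ᵀ (X +ᵀ Z) ⟧ j                      ∎

    +ᵀ-distrib : ∀ X Y Z → (Y ⋆ᵀ Z) +ᵀ X ≈ᵀ (Y +ᵀ X) ⋆ᵀ (Z +ᵀ X)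
    +ᵀ-distrib X Y Z j = begin
      ⟦ (Y ⋆ᵀ Z) +ᵀ X ⟧ j            ≈⟨ +ᵀ-comm (Y ⋆ᵀ Z) X j ⟩
      ⟦ X +ᵀ (Y ⋆ᵀ Z) ⟧ j            ≈⟨ +ᵀ-distribˡ X Y Z j ⟩
      ⟦ (X +ᵀ Y) ⋆ᵀ (X +ᵀ Z) ⟧ j     ≈⟨ ⋆ᵀ-cong (+ᵀ-comm X Y) (+ᵀ-comm X Z) j ⟩
      ⟦ (Y +ᵀ X) ⋆ᵀ (Z +ᵀ X) ⟧ j     ∎

  open Distrib _∨_ _∨ᵀ_ (λ {X X′ Y Y′} → ∨ᵀ-cong {X} {X′} {Y} {Y′}) ⟦⟧-∨ ⊞⋆-distrib-∨ˢ ∨-cong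
    renaming (+ᵀ-distribˡ to +ᵀ-distribˡ-∨; +ᵀ-distrib to +ᵀ-distribʳ-∨)
  open Distrib _∧_ _∧ᵀ_ (λ {X X′ Y Y′} → ∧ᵀ-cong {X} {X′} {Y} {Y′}) ⟦⟧-∧ ⊞⋆-distrib-∧ˢ ∧-cong
    renaming (+ᵀ-distribˡ to +ᵀ-distribˡ-∧; +ᵀ-distrib to +ᵀ-distribʳ-∧)

  ≤ˢ⇒≤ᵀ : ∀ X Y → ⟦ X ⟧ ≤ˢ ⟦ Y ⟧ → X ≈ᵀ X ∧ᵀ Y
  ≤ˢ⇒≤ᵀ X Y X≤Y j = trans (X≤Y j) (sym (⟦⟧-∧ X Y j))

  ≤ᵀ⇒≤ˢ : ∀ X Y → X ≈ᵀ X ∧ᵀ Y → ⟦ X ⟧ ≤ˢ ⟦ Y ⟧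
  ≤ᵀ⇒≤ˢ X Y X≤Y j = trans (X≤Y j) (⟦⟧-∧ X Y j)

  toSeq-≤-replicate : ∀ xs → toSeq xs ≤ˢ toSeq (replicate (length xs) 1#)
  toSeq-≤-replicate []       j = ≤-refl
  toSeq-≤-replicate (x ∷ xs)   = ⊞-mono (toSeq-≤-replicate xs) (x≤1 x)

  toSeq-replicate-mono : ∀ {m n} → m ℕ.≤ n → toSeq (replicate m 1#) ≤ˢ toSeq (replicate n 1#)
  toSeq-replicate-mono {n = n} z≤n = ⊞⋆-inflationary (replicate n 1#) zeroˢ
  toSeq-replicate-mono (s≤s m≤n)  = ⊞-mono (toSeq-replicate-mono m≤n) ≤-refl

  n·-1ᵀ≡ : ∀ n → iterate-sum _+ᵀ_ 0ᵀ n -1ᵀ ≡ ([] , n)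
  n·-1ᵀ≡ zero    = ≡.refl
  n·-1ᵀ≡ (suc n) = ≡.cong (-1ᵀ +ᵀ_) (n·-1ᵀ≡ n)

  n·1ᵀ≡ : ∀ n → iterate-sum _+ᵀ_ 0ᵀ n 1ᵀ ≡ (replicate n 1# , 0)
  n·1ᵀ≡ zero    = ≡.refl
  n·1ᵀ≡ (suc n) = ≡.cong (1ᵀ +ᵀ_) (n·1ᵀ≡ n)

  -- (xs , s) lies between −n and n for n = length xs + s.
  strongUnit : ∀ X → ∃ λ n → iterate-sum _+ᵀ_ 0ᵀ n -1ᵀ ≈ᵀ iterate-sum _+ᵀ_ 0ᵀ n -1ᵀ ∧ᵀ X
                           × X ≈ᵀ X ∧ᵀ iterate-sum _+ᵀ_ 0ᵀ n 1ᵀ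
  strongUnit X@(xs , s) =
    n , ≡.subst (λ N → N ≈ᵀ N ∧ᵀ X) (≡.sym (n·-1ᵀ≡ n)) (≤ˢ⇒≤ᵀ ([] , n) X lower)
      , ≡.subst (λ N → X ≈ᵀ X ∧ᵀ N) (≡.sym (n·1ᵀ≡ n)) (≤ˢ⇒≤ᵀ X (replicate n 1# , 0) upper)
    where
      n = length xs ℕ.+ s
      lower : ⟦ [] , n ⟧ ≤ˢ ⟦ xs , s ⟧
      lower j = ≤-respˡ-≈ (≡⇒≈ (≡.cong zeroˢ (≡.sym (+ⁿ-+ j (length xs) s))))
        (≤-trans (Good-antitone Good-zeroˢ (j +ⁿ s) (length xs)) (⊞⋆-inflationary xs zeroˢ (j +ⁿ s)))
      upper : ⟦ xs , s ⟧ ≤ˢ ⟦ replicate n 1# , 0 ⟧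
      upper j = ≤-trans (Good-antitone (Good-toSeq xs) j s)
        (≤-trans (toSeq-≤-replicate xs j) (toSeq-replicate-mono (ℕ.m≤m+n (length xs) s) j))

  ulm : ULM c ℓ
  ulm = record
    { Carrier = Term ; _≈_ = _≈ᵀ_ ; _+_ = _+ᵀ_ ; _∨_ = _∨ᵀ_ ; _∧_ = _∧ᵀ_
    ; 0# = 0ᵀ ; 1# = 1ᵀ ; -1# = -1ᵀ
    ; isDistributiveLattice = isDistributiveLattice
    ; +-isCommutativeMonoid = +ᵀ-isCommutativeMonoid
    ; +-distrib-∨ = +ᵀ-distribˡ-∨ , +ᵀ-distribʳ-∨
    ; +-distrib-∧ = +ᵀ-distribˡ-∧ , +ᵀ-distribʳ-∧
    ; -1+1≈0 = λ j → trans (⊞-1# Good-zeroˢ (sucℤ j)) (≡⇒≈ (≡.cong zeroˢ (pred-suc j)))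
    ; 0≤1 = ≤ˢ⇒≤ᵀ 0ᵀ 1ᵀ (⊞⋆-inflationary (1# ∷ []) zeroˢ)
    ; strongUnit = strongUnit
    }

  toSeq-[x]-0 : ∀ x → toSeq (x ∷ []) (+ 0) ≈ x
  toSeq-[x]-0 x = trans (⊕-identityˡ _) (⊙-identityˡ x)

  toSeq-[x,y]-0 : ∀ x y → toSeq (x ∷ y ∷ []) (+ 0) ≈ x ⊕ y
  toSeq-[x,y]-0 x y = trans (⊕-cong (toSeq-[x]-0 y) (trans (⊙-congʳ (toSeq-negative (y ∷ []) 0)) (⊙-identityˡ x)))
                            (⊕-comm y x)

  toSeq-[x,y]-1 : ∀ x y → toSeq (x ∷ y ∷ []) (+ 1) ≈ x ⊙ y
  toSeq-[x,y]-1 x y = trans (⊕-cong (toSeq-vanishes (y ∷ []) 1 (s≤s z≤n)) (⊙-congʳ (toSeq-[x]-0 y)))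
                            (trans (⊕-identityˡ _) (⊙-comm y x))

  ι : Carrier → Term
  ι x = x ∷ [] , 0

  ι-⊕ : ∀ x y → ι (x ⊕ y) ≈ᵀ (ι x +ᵀ ι y) ∧ᵀ 1ᵀ
  ι-⊕ x y j = trans (value j) (sym (⟦⟧-∧ (ι x +ᵀ ι y) 1ᵀ j))
    where
      value : ∀ j → toSeq (x ⊕ y ∷ []) j ≈ toSeq (x ∷ y ∷ []) j ∧ toSeq (1# ∷ []) j
      value (+ zero)   = trans (toSeq-[x]-0 _)
        (sym (trans (∧-cong (toSeq-[x,y]-0 x y) (toSeq-[x]-0 1#)) (∧-identityʳ _)))
      value (+ suc k)  = trans (toSeq-vanishes (x ⊕ y ∷ []) (suc k) (s≤s z≤n))
        (sym (trans (∧-congˡ (toSeq-vanishes (1# ∷ []) (suc k) (s≤s z≤n))) (∧-zeroʳ _)))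
      value -[1+ n ]   = trans (toSeq-negative (x ⊕ y ∷ []) n)
        (sym (trans (∧-cong (toSeq-negative (x ∷ y ∷ []) n) (toSeq-negative (1# ∷ []) n)) (∧-idem 1#)))

  ι-⊙ : ∀ x y → ι (x ⊙ y) ≈ᵀ ((ι x +ᵀ ι y) +ᵀ -1ᵀ) ∨ᵀ 0ᵀ
  ι-⊙ x y j = trans (value j) (sym (⟦⟧-∨ ((ι x +ᵀ ι y) +ᵀ -1ᵀ) 0ᵀ j))
    where
      value : ∀ j → toSeq (x ⊙ y ∷ []) j ≈ toSeq (x ∷ y ∷ []) (sucℤ j) ∨ zeroˢ j
      value (+ zero)   = trans (toSeq-[x]-0 _) (sym (trans (∨-identityʳ _) (toSeq-[x,y]-1 x y)))
      value (+ suc k)  = trans (toSeq-vanishes (x ⊙ y ∷ []) (suc k) (s≤s z≤n))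
        (sym (trans (∨-identityʳ _) (toSeq-vanishes (x ∷ y ∷ []) (suc (suc k)) (s≤s (s≤s z≤n)))))
      value -[1+ n ]   = trans (toSeq-negative (x ⊙ y ∷ []) n) (sym (∨-zeroʳ _))

  open ULMLemmas ulm using (InUnit)

  ι-InUnit : ∀ x → InUnit (ι x)
  ι-InUnit x = ≤ˢ⇒≤ᵀ 0ᵀ (ι x) (⊞⋆-inflationary (x ∷ []) zeroˢ)
             , ≤ˢ⇒≤ᵀ (ι x) 1ᵀ (⊞-mono {zeroˢ} (λ j → ≤-refl) (x≤1 x))

  ιΓ : MVMHom (MVM.raw A) (Γ ulm)
  ιΓ = record
    { ⟦_⟧ = λ x → ι x , ι-InUnit x
    ; cong = ⊞-cong {zeroˢ} (λ j → refl)
    ; ⊕-hom = ι-⊕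
    ; ⊙-hom = ι-⊙
    ; ∨-hom = λ x y j → trans (⊞-distribˡ-∨ zeroˢ x y j) (sym (⟦⟧-∨ (ι x) (ι y) j))
    ; ∧-hom = λ x y j → trans (⊞-distribˡ-∧ zeroˢ x y j) (sym (⟦⟧-∧ (ι x) (ι y) j))
    ; 0-hom = ⊞-0# zeroˢ
    ; 1-hom = λ j → refl
    }

  value-at-0 : RawMVM.Carrier (Γ ulm) → Carrier
  value-at-0 (X , _) = ⟦ X ⟧ (+ 0)

  -- An element of the unit interval of Ξ has good sequence (…, 1, 1, x, 0, 0, …).
  ι-value-at-0 : ∀ (X : RawMVM.Carrier (Γ ulm)) → ι (value-at-0 X) ≈ᵀ proj₁ X
  ι-value-at-0 (X , 0≤X , X≤1) (+ zero)  = toSeq-[x]-0 _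
  ι-value-at-0 (X , 0≤X , X≤1) (+ suc k) =
    trans (toSeq-vanishes (_ ∷ []) (suc k) (s≤s z≤n))
          (antisym (0≤x _) (≤-trans (≤ᵀ⇒≤ˢ X 1ᵀ X≤1 (+ suc k))
                                    (≤-reflexive (toSeq-vanishes (1# ∷ []) (suc k) (s≤s z≤n)))))
  ι-value-at-0 (X , 0≤X , X≤1) -[1+ n ]  =
    trans (toSeq-negative (_ ∷ []) n) (antisym (≤ᵀ⇒≤ˢ 0ᵀ X 0≤X -[1+ n ]) (x≤1 _))

  Γ-iso : MVMIso (Γ ulm) (MVM.raw A)
  Γ-iso = Γ-iso-from-inverse ulm ιΓ value-at-0 (λ X≈Y → X≈Y (+ 0)) toSeq-[x]-0 ι-value-at-0

module ULMProperties {c ℓ} (M : ULM c ℓ) where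
  open ULM M public
    using (Carrier; _≈_; _+_; _∨_; _∧_; _·_; 0#; 1#; -1#; refl; sym; trans;
           +-assoc; +-comm; +-identityˡ; +-identityʳ; +-cong; +-distrib-∨; +-distrib-∧;
           ∨-cong; ∨-comm; ∨-assoc; ∧-cong; ∧-comm; ∧-assoc; ∨-distrib-∧; ∧-distrib-∨;
           -1+1≈0; 0≤1; strongUnit)
  open ULM M using (+-isCommutativeMonoid)
  open ULMLemmas M public using (lattice; InUnit; +-monoˡ-≤; +-mono-≤)
  open LatticeOrder lattice public
  open Lattice lattice public using (setoid; ∨-congˡ; ∨-congʳ; ∧-congˡ; ∧-congʳ)
  open SetoidReasoning setoid

  +-commutativeMonoid : CommutativeMonoid c ℓ
  +-commutativeMonoid = record { isCommutativeMonoid = +-isCommutativeMonoid }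
  open CommutativeSemigroupProperties (CommutativeMonoid.commutativeSemigroup +-commutativeMonoid)
    public using (interchange; xy∙z≈xz∙y)
  open CommutativeMonoid +-commutativeMonoid public using () renaming (∙-congˡ to +-congˡ; ∙-congʳ to +-congʳ)

  infixl 6 _⊕_
  infixl 7 _⊙_
  _⊕_ _⊙_ : Carrier → Carrier → Carrier
  x ⊕ y = (x + y) ∧ 1#
  x ⊙ y = ((x + y) + -1#) ∨ 0#

  rest : Carrier → Carrier
  rest y = (y + -1#) ∨ 0#

  clamp : Carrier → Carrier
  clamp y = (y ∨ 0#) ∧ 1#

  1+-1≈0 : 1# + -1# ≈ 0#
  1+-1≈0 = trans (+-comm 1# -1#) -1+1≈0

  x+1+-1≈x : ∀ x → (x + 1#) + -1# ≈ x
  x+1+-1≈x x = trans (+-assoc x 1# -1#) (trans (+-congˡ 1+-1≈0) (+-identityʳ x))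

  x+-1+1≈x : ∀ x → (x + -1#) + 1# ≈ x
  x+-1+1≈x x = trans (+-assoc x -1# 1#) (trans (+-congˡ -1+1≈0) (+-identityʳ x))

  -1≤0 : -1# ≤ 0#
  -1≤0 = ≤-respˡ-≈ (+-identityʳ -1#) (≤-respʳ-≈ -1+1≈0 (+-mono-≤ ≤-refl 0≤1))

  +-nonneg : ∀ {a b} → 0# ≤ a → 0# ≤ b → 0# ≤ a + b
  +-nonneg 0≤a 0≤b = ≤-respˡ-≈ (+-identityʳ 0#) (+-mono-≤ 0≤a 0≤b)

  x∨0+x∧0≈x : ∀ x → (x ∨ 0#) + (x ∧ 0#) ≈ x
  x∨0+x∧0≈x x = antisym
    (≤-respˡ-≈ (sym (proj₂ +-distrib-∨ (x ∧ 0#) x 0#)) (∨-least x+x∧0≤x 0+x∧0≤x))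
    (≤-respʳ-≈ (sym (proj₁ +-distrib-∧ (x ∨ 0#) x 0#)) (∧-greatest x≤x∨0+x x≤x∨0+0))
    where
      x+x∧0≤x : x + (x ∧ 0#) ≤ x
      x+x∧0≤x = ≤-respˡ-≈ (sym (proj₁ +-distrib-∧ x x 0#)) (≤-trans (x∧y≤y _ _) (≤-reflexive (+-identityʳ x)))
      0+x∧0≤x : 0# + (x ∧ 0#) ≤ x
      0+x∧0≤x = ≤-respˡ-≈ (sym (+-identityˡ _)) (x∧y≤x x 0#)
      x≤x∨0+x : x ≤ (x ∨ 0#) + x
      x≤x∨0+x = ≤-respʳ-≈ (sym (proj₂ +-distrib-∨ x x 0#)) (≤-trans (≤-reflexive (sym (+-identityˡ x))) (y≤x∨y _ _))
      x≤x∨0+0 : x ≤ (x ∨ 0#) + 0#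
      x≤x∨0+0 = ≤-respʳ-≈ (sym (+-identityʳ _)) (x≤x∨y x 0#)

  -- Applied to y − 1, x∨0+x∧0≈x splits y into its first digit and the rest.
  y∧1+rest≈y : ∀ y → (y ∧ 1#) + rest y ≈ y
  y∧1+rest≈y y = begin
    (y ∧ 1#) + rest y                     ≈⟨ +-comm _ _ ⟩
    (z ∨ 0#) + (y ∧ 1#)                   ≈⟨ +-congˡ (∧-cong (x+-1+1≈x y) (+-identityˡ 1#)) ⟨
    (z ∨ 0#) + ((z + 1#) ∧ (0# + 1#))     ≈⟨ +-congˡ (proj₂ +-distrib-∧ 1# z 0#) ⟨
    (z ∨ 0#) + ((z ∧ 0#) + 1#)            ≈⟨ +-assoc _ _ _ ⟨
    ((z ∨ 0#) + (z ∧ 0#)) + 1#            ≈⟨ +-congʳ (x∨0+x∧0≈x z) ⟩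
    z + 1#                                ≈⟨ x+-1+1≈x y ⟩
    y                                     ∎
    where z = y + -1#

  x⊕y+x⊙y≈x+y : ∀ x y → (x ⊕ y) + (x ⊙ y) ≈ x + y
  x⊕y+x⊙y≈x+y x y = y∧1+rest≈y (x + y)

  rest-nonneg : ∀ y → 0# ≤ rest y
  rest-nonneg y = y≤x∨y _ _

  rest≤ : ∀ {y} → 0# ≤ y → rest y ≤ y
  rest≤ {y} 0≤y = ∨-least (≤-respʳ-≈ (+-identityʳ y) (+-mono-≤ ≤-refl -1≤0)) 0≤y

  rest-∨ : ∀ a b → rest (a ∨ b) ≈ rest a ∨ rest b
  rest-∨ a b = trans (∨-congʳ (proj₂ +-distrib-∨ -1# a b)) (∨-distribʳ-∨ _ _ _)

  rest-∧ : ∀ a b → rest (a ∧ b) ≈ rest a ∧ rest b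
  rest-∧ a b = trans (∨-congʳ (proj₂ +-distrib-∧ -1# a b)) (proj₂ ∨-distrib-∧ 0# _ _)

  clamp-nonneg : ∀ {y} → 0# ≤ y → clamp y ≈ y ∧ 1#
  clamp-nonneg {y} 0≤y = ∧-congʳ (trans (∨-comm y 0#) (x≤y⇒x∨y≈y 0≤y))

  clamp-InUnit : ∀ {e} → InUnit e → clamp e ≈ e
  clamp-InUnit (0≤e , e≤1) = trans (clamp-nonneg 0≤e) (sym e≤1)

  clamp-∨ : ∀ y y′ → clamp (y ∨ y′) ≈ clamp y ∨ clamp y′
  clamp-∨ y y′ = trans (∧-congʳ (∨-distribʳ-∨ y y′ 0#)) (proj₂ ∧-distrib-∨ 1# _ _)

  clamp-∧ : ∀ y y′ → clamp (y ∧ y′) ≈ clamp y ∧ clamp y′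
  clamp-∧ y y′ = trans (∧-congʳ (proj₂ ∨-distrib-∧ 0# y y′)) (∧-distribʳ-∧ _ _ _)

  InUnit-clamp : ∀ y → InUnit (clamp y)
  InUnit-clamp y = ∧-greatest (y≤x∨y y 0#) 0≤1 , x∧y≤y _ 1#

  1≤x+1 : ∀ {x} → 0# ≤ x → 1# ≤ x + 1#
  1≤x+1 0≤x = ≤-respˡ-≈ (+-identityˡ 1#) (+-monoˡ-≤ 1# 0≤x)

  [x+y∧1]∧1≈[x+y]∧1 : ∀ {x} y → 0# ≤ x → (x + (y ∧ 1#)) ∧ 1# ≈ (x + y) ∧ 1#
  [x+y∧1]∧1≈[x+y]∧1 {x} y 0≤x = begin
    (x + (y ∧ 1#)) ∧ 1#        ≈⟨ ∧-congʳ (proj₁ +-distrib-∧ x y 1#) ⟩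
    ((x + y) ∧ (x + 1#)) ∧ 1#  ≈⟨ ∧-assoc _ _ _ ⟩
    (x + y) ∧ ((x + 1#) ∧ 1#)  ≈⟨ ∧-congˡ (trans (∧-comm _ _) (sym (1≤x+1 0≤x))) ⟩
    (x + y) ∧ 1#               ∎

  ⊕-cong : ∀ {x x′ y y′} → x ≈ x′ → y ≈ y′ → x ⊕ y ≈ x′ ⊕ y′
  ⊕-cong x≈x′ y≈y′ = ∧-congʳ (+-cong x≈x′ y≈y′)

  ⊙-cong : ∀ {x x′ y y′} → x ≈ x′ → y ≈ y′ → x ⊙ y ≈ x′ ⊙ y′
  ⊙-cong x≈x′ y≈y′ = ∨-congʳ (+-congʳ (+-cong x≈x′ y≈y′))

  clamp-+ : ∀ {y e} → 0# ≤ y → 0# ≤ e → clamp (y + e) ≈ clamp y ⊕ e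
  clamp-+ {y} {e} 0≤y 0≤e = begin
    clamp (y + e)        ≈⟨ clamp-nonneg (+-nonneg 0≤y 0≤e) ⟩
    (y + e) ∧ 1#         ≈⟨ ∧-congʳ (+-comm y e) ⟩
    (e + y) ∧ 1#         ≈⟨ [x+y∧1]∧1≈[x+y]∧1 y 0≤e ⟨
    (e + (y ∧ 1#)) ∧ 1#  ≈⟨ ∧-congʳ (trans (+-comm e _) (+-congʳ (sym (clamp-nonneg 0≤y)))) ⟩
    clamp y ⊕ e          ∎

  rest-+ : ∀ {y e} → 0# ≤ y → 0# ≤ e → rest (y + e) ≈ rest y + clamp y ⊙ e
  rest-+ {y} {e} 0≤y 0≤e = sym (begin
    rest y + clamp y ⊙ e                               ≈⟨ +-congˡ (⊙-cong (clamp-nonneg 0≤y) refl) ⟩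
    rest y + (y ∧ 1#) ⊙ e                              ≈⟨ proj₁ +-distrib-∨ (rest y) _ 0# ⟩
    (rest y + (((y ∧ 1#) + e) + -1#)) ∨ (rest y + 0#)  ≈⟨ ∨-cong regroup (+-identityʳ _) ⟩
    ((y + e) + -1#) ∨ ((y + -1#) ∨ 0#)                 ≈⟨ ∨-assoc _ _ _ ⟨
    (((y + e) + -1#) ∨ (y + -1#)) ∨ 0#                 ≈⟨ ∨-congʳ (trans (∨-comm _ _) (x≤y⇒x∨y≈y y-1≤y+e-1)) ⟩
    rest (y + e)                                       ∎)
    where
      regroup : rest y + (((y ∧ 1#) + e) + -1#) ≈ (y + e) + -1#
      regroup = begin
        rest y + (((y ∧ 1#) + e) + -1#)  ≈⟨ +-assoc _ _ _ ⟨
        (rest y + ((y ∧ 1#) + e)) + -1#  ≈⟨ +-congʳ (+-assoc _ _ _) ⟨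
        ((rest y + (y ∧ 1#)) + e) + -1#  ≈⟨ +-congʳ (+-congʳ (trans (+-comm _ _) (y∧1+rest≈y y))) ⟩
        (y + e) + -1#                    ∎
      y-1≤y+e-1 : y + -1# ≤ (y + e) + -1#
      y-1≤y+e-1 = +-monoˡ-≤ -1# (≤-respˡ-≈ (+-identityʳ y) (+-mono-≤ ≤-refl 0≤e))

  clamp⊕clamp-rest≈clamp : ∀ {y} → 0# ≤ y → clamp y ⊕ clamp (rest y) ≈ clamp y
  clamp⊕clamp-rest≈clamp {y} 0≤y = begin
    clamp y ⊕ clamp (rest y)  ≈⟨ ⊕-cong (clamp-nonneg 0≤y) (clamp-nonneg (rest-nonneg y)) ⟩
    (y ∧ 1#) ⊕ (rest y ∧ 1#)  ≈⟨ [x+y∧1]∧1≈[x+y]∧1 (rest y) (∧-greatest 0≤y 0≤1) ⟩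
    ((y ∧ 1#) + rest y) ∧ 1#  ≈⟨ ∧-congʳ (y∧1+rest≈y y) ⟩
    y ∧ 1#                    ≈⟨ clamp-nonneg 0≤y ⟨
    clamp y                   ∎

  clamp⊙clamp-rest≈clamp-rest : ∀ {y} → 0# ≤ y → clamp y ⊙ clamp (rest y) ≈ clamp (rest y)
  clamp⊙clamp-rest≈clamp-rest {y} 0≤y = begin
    clamp y ⊙ clamp (rest y)                          ≈⟨ ⊙-cong (clamp-nonneg 0≤y) (clamp-nonneg (rest-nonneg y)) ⟩
    ((d + (rest y ∧ 1#)) + -1#) ∨ 0#                  ≈⟨ ∨-congʳ (+-congʳ (proj₁ +-distrib-∧ d (rest y) 1#)) ⟩
    (((d + rest y) ∧ (d + 1#)) + -1#) ∨ 0#            ≈⟨ ∨-congʳ (proj₂ +-distrib-∧ -1# _ _) ⟩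
    (((d + rest y) + -1#) ∧ ((d + 1#) + -1#)) ∨ 0#    ≈⟨ ∨-congʳ (∧-cong (+-congʳ (y∧1+rest≈y y)) (x+1+-1≈x d)) ⟩
    ((y + -1#) ∧ d) ∨ 0#                              ≈⟨ proj₂ ∨-distrib-∧ 0# _ _ ⟩
    rest y ∧ (d ∨ 0#)                                 ≈⟨ ∧-congˡ (trans (∨-comm _ _) (x≤y⇒x∨y≈y 0≤d)) ⟩
    rest y ∧ (y ∧ 1#)                                 ≈⟨ ∧-assoc _ _ _ ⟨
    (rest y ∧ y) ∧ 1#                                 ≈⟨ ∧-congʳ (sym (rest≤ 0≤y)) ⟩
    rest y ∧ 1#                                       ≈⟨ clamp-nonneg (rest-nonneg y) ⟨
    clamp (rest y)                                    ∎
    where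
      d = y ∧ 1#
      0≤d : 0# ≤ d
      0≤d = ∧-greatest 0≤y 0≤1

  good-pair⇒∧1 : ∀ {u R} → 0# ≤ u → u ⊕ (R ∧ 1#) ≈ u → (u + R) ∧ 1# ≈ u
  good-pair⇒∧1 {u} {R} 0≤u u⊕r≈u = trans (sym ([x+y∧1]∧1≈[x+y]∧1 R 0≤u)) u⊕r≈u

  good-pair⇒rest : ∀ {u R} → 0# ≤ u → 0# ≤ R → u ⊙ (R ∧ 1#) ≈ R ∧ 1# → rest (u + R) ≈ R
  good-pair⇒rest {u} {R} 0≤u 0≤R w∨0≈r = begin
    ((u + R) + -1#) ∨ 0#    ≈⟨ ∨-congʳ u+R-1≈w+R′ ⟩
    (w + R′) ∨ 0#           ≈⟨ antisym (∨-monotonic ≤-refl (rest-nonneg R)) (∨-least (x≤x∨y _ _) R′≤) ⟩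
    (w + R′) ∨ R′           ≈⟨ ∨-congˡ (+-identityˡ R′) ⟨
    (w + R′) ∨ (0# + R′)    ≈⟨ proj₂ +-distrib-∨ R′ w 0# ⟨
    (w ∨ 0#) + R′           ≈⟨ +-congʳ w∨0≈r ⟩
    r + R′                  ≈⟨ y∧1+rest≈y R ⟩
    R                       ∎
    where
      r = R ∧ 1#
      R′ = rest R
      w = (u + r) + -1#
      u+R-1≈w+R′ : (u + R) + -1# ≈ w + R′
      u+R-1≈w+R′ = begin
        (u + R) + -1#         ≈⟨ +-congʳ (+-congˡ (y∧1+rest≈y R)) ⟨
        (u + (r + R′)) + -1#  ≈⟨ +-congʳ (+-assoc u r R′) ⟨
        ((u + r) + R′) + -1#  ≈⟨ xy∙z≈xz∙y _ _ _ ⟩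
        w + R′                ∎
      w+R′≈R+w∧0 : w + R′ ≈ R + (w ∧ 0#)
      w+R′≈R+w∧0 = begin
        w + R′                           ≈⟨ +-congʳ (x∨0+x∧0≈x w) ⟨
        ((w ∨ 0#) + (w ∧ 0#)) + R′       ≈⟨ +-congʳ (+-congʳ w∨0≈r) ⟩
        (r + (w ∧ 0#)) + R′              ≈⟨ xy∙z≈xz∙y _ _ _ ⟩
        (r + R′) + (w ∧ 0#)              ≈⟨ +-congʳ (y∧1+rest≈y R) ⟩
        R + (w ∧ 0#)                     ∎
      -1≤w∧0 : -1# ≤ w ∧ 0#
      -1≤w∧0 = ∧-greatest (≤-respˡ-≈ (+-identityˡ -1#)
                             (+-monoˡ-≤ -1# (+-nonneg 0≤u (∧-greatest 0≤R 0≤1)))) -1≤0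
      R′≤ : R′ ≤ (w + R′) ∨ 0#
      R′≤ = ∨-monotonic (≤-trans (+-mono-≤ ≤-refl -1≤w∧0) (≤-reflexive (sym w+R′≈R+w∧0))) ≤-refl

  ·-homo-+ : ∀ a m n → (m ℕ.+ n) · a ≈ m · a + n · a
  ·-homo-+ a zero    n = sym (+-identityˡ _)
  ·-homo-+ a (suc m) n = trans (+-congˡ (·-homo-+ a m n)) (sym (+-assoc a _ _))

  ·-congʳ : ∀ n {a b} → a ≈ b → n · a ≈ n · b
  ·-congʳ zero    a≈b = refl
  ·-congʳ (suc n) a≈b = +-cong a≈b (·-congʳ n a≈b)

  n·1+n·-1≈0 : ∀ n → n · 1# + n · -1# ≈ 0#
  n·1+n·-1≈0 zero    = +-identityʳ 0#
  n·1+n·-1≈0 (suc n) = trans (interchange 1# (n · 1#) -1# (n · -1#))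
                             (trans (+-cong 1+-1≈0 (n·1+n·-1≈0 n)) (+-identityʳ 0#))

  0≤n·1 : ∀ n → 0# ≤ n · 1#
  0≤n·1 zero    = ≤-refl
  0≤n·1 (suc n) = +-nonneg 0≤1 (0≤n·1 n)

  infix 4 _∈[0,_] _∈[±_]
  record _∈[0,_] (y : Carrier) (m : ℕ) : Set ℓ where
    constructor _,_
    field
      lower : 0# ≤ y
      upper : y ≤ m · 1#

  record _∈[±_] (x : Carrier) (n : ℕ) : Set ℓ where
    constructor _,_
    field
      lower : n · -1# ≤ x
      upper : x ≤ n · 1#

  bound : Carrier → ℕ
  bound x = proj₁ (strongUnit x)

  bound-∈[±] : ∀ x → x ∈[± bound x ]
  bound-∈[±] x = proj₁ (proj₂ (strongUnit x)) , proj₂ (proj₂ (strongUnit x))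

  ∈[0,0]⇒≈0 : ∀ {y} → y ∈[0, 0 ] → y ≈ 0#
  ∈[0,0]⇒≈0 (0≤y , y≤0) = antisym y≤0 0≤y

  rest-∈[0,] : ∀ {y} m → y ∈[0, suc m ] → rest y ∈[0, m ]
  rest-∈[0,] {y} m (_ , y≤) =
    rest-nonneg y ,
    ∨-least (≤-respʳ-≈ (trans (+-congʳ (+-comm 1# (m · 1#))) (x+1+-1≈x (m · 1#))) (+-monoˡ-≤ -1# y≤))
            (0≤n·1 m)

  +-InUnit-∈[0,] : ∀ {y e m} → y ∈[0, m ] → InUnit e → y + e ∈[0, suc m ]
  +-InUnit-∈[0,] (0≤y , y≤) (0≤e , e≤1) = +-nonneg 0≤y 0≤e , ≤-respʳ-≈ (+-comm _ _) (+-mono-≤ y≤ e≤1)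

  +-∈[±] : ∀ {x x′ m n} → x ∈[± m ] → x′ ∈[± n ] → x + x′ ∈[± m ℕ.+ n ]
  +-∈[±] {m = m} {n} (lo , hi) (lo′ , hi′) =
    ≤-respˡ-≈ (sym (·-homo-+ -1# m n)) (+-mono-≤ lo lo′) ,
    ≤-respʳ-≈ (sym (·-homo-+ 1# m n)) (+-mono-≤ hi hi′)

  ∈[±]-resp-≈ : ∀ {n x x′} → x ≈ x′ → x ∈[± n ] → x′ ∈[± n ]
  ∈[±]-resp-≈ x≈x′ (lo , hi) = ≤-respʳ-≈ x≈x′ lo , ≤-respˡ-≈ x≈x′ hi

  ∈[±]-weaken : ∀ k {n x} → x ∈[± n ] → x ∈[± k ℕ.+ n ]
  ∈[±]-weaken k {n} x∈ = ∈[±]-resp-≈ (+-identityˡ _) (+-∈[±] (n·-1≤0 k , 0≤n·1 k) x∈)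
    where
      n·-1≤0 : ∀ k → k · -1# ≤ 0#
      n·-1≤0 zero    = ≤-refl
      n·-1≤0 (suc k) = ≤-respʳ-≈ (+-identityʳ 0#) (+-mono-≤ -1≤0 (n·-1≤0 k))

  ∨-∈[±] : ∀ {n x x′} → x ∈[± n ] → x′ ∈[± n ] → x ∨ x′ ∈[± n ]
  ∨-∈[±] (lo , hi) (lo′ , hi′) = ≤-trans lo (x≤x∨y _ _) , ∨-least hi hi′

  ∧-∈[±] : ∀ {n x x′} → x ∈[± n ] → x′ ∈[± n ] → x ∧ x′ ∈[± n ]
  ∧-∈[±] (lo , hi) (lo′ , hi′) = ∧-greatest lo lo′ , ≤-trans (x∧y≤x _ _) hi

  shift-∈[0,] : ∀ {x} n → x ∈[± n ] → x + n · 1# ∈[0, n ℕ.+ n ]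
  shift-∈[0,] {x} n (lo , hi) =
    ≤-respˡ-≈ (trans (+-comm _ _) (n·1+n·-1≈0 n)) (+-monoˡ-≤ (n · 1#) lo) ,
    ≤-respʳ-≈ (sym (·-homo-+ 1# n n)) (+-monoˡ-≤ (n · 1#) hi)

  shift-back : ∀ x n → (x + n · 1#) + n · -1# ≈ x
  shift-back x n = trans (+-assoc x _ _) (trans (+-congˡ (n·1+n·-1≈0 n)) (+-identityʳ x))

module ULMHomProperties {c₁ ℓ₁ c₂ ℓ₂} {M : ULM c₁ ℓ₁} {N : ULM c₂ ℓ₂} (f : ULMHom M N) where
  private
    module M = ULMProperties M
    module N = ULMProperties N
  open ULMHom f

  ·-homo : ∀ n a → ⟦ n M.· a ⟧ N.≈ n N.· ⟦ a ⟧
  ·-homo zero    a = 0-hom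
  ·-homo (suc n) a = N.trans (+-hom a _) (N.+-congˡ (·-homo n a))

  n·-1-homo : ∀ n → ⟦ n M.· M.-1# ⟧ N.≈ n N.· N.-1#
  n·-1-homo n = N.trans (·-homo n M.-1#) (N.·-congʳ n -1-hom)

module Faithful {c ℓ} {M N : ULM c ℓ} (f g : ULMHom M N)
                (agree : ∀ e → RawMVM._≈_ (Γ N) (Γ-map f e) (Γ-map g e)) where
  open ULMProperties M
  private
    module N = ULMProperties N
    module f = ULMHom f
    module g = ULMHom g

  Agree : Carrier → Set ℓ
  Agree x = f.⟦ x ⟧ N.≈ g.⟦ x ⟧

  agree-resp : ∀ {x y} → x ≈ y → Agree x → Agree y
  agree-resp x≈y fx≈gx = N.trans (f.cong (sym x≈y)) (N.trans fx≈gx (g.cong x≈y))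

  agree-+ : ∀ {x y} → Agree x → Agree y → Agree (x + y)
  agree-+ {x} {y} fx≈gx fy≈gy =
    N.trans (f.+-hom x y) (N.trans (N.+-cong fx≈gx fy≈gy) (N.sym (g.+-hom x y)))

  agree-0 : Agree 0#
  agree-0 = N.trans f.0-hom (N.sym g.0-hom)

  agree-∈[0,] : ∀ m {y} → y ∈[0, m ] → Agree y
  agree-∈[0,] zero    y∈ = agree-resp (sym (∈[0,0]⇒≈0 y∈)) agree-0
  agree-∈[0,] (suc m) {y} y∈@(0≤y , _) = agree-resp (y∧1+rest≈y y)
    (agree-+ (agree (y ∧ 1# , ∧-greatest 0≤y 0≤1 , x∧y≤y y 1#)) (agree-∈[0,] m (rest-∈[0,] m y∈)))

  faithful : ∀ x → Agree x
  faithful x = agree-resp (shift-back x n)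
    (agree-+ (agree-∈[0,] (n ℕ.+ n) (shift-∈[0,] n (bound-∈[±] x)))
             (N.trans (ULMHomProperties.n·-1-homo f n) (N.sym (ULMHomProperties.n·-1-homo g n))))
    where n = bound x

module Full {c ℓ} (M N : ULM c ℓ) (h : MVMHom (Γ M) (Γ N)) where
  open ULMProperties M
  private
    module N = ULMProperties N
    module h = MVMHom h
    module ΓM = RawMVM (Γ M)
  open CommutativeSemigroupProperties ℕ.+-commutativeSemigroup using () renaming (interchange to ℕ-interchange)
  open SetoidReasoning N.setoid

  ĥ : ΓM.Carrier → N.Carrier
  ĥ e = proj₁ h.⟦ e ⟧

  ĥ-nonneg : ∀ e → N.0# N.≤ ĥ e
  ĥ-nonneg e = proj₁ (proj₂ h.⟦ e ⟧)

  clampΓ : Carrier → ΓM.Carrier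
  clampΓ y = clamp y , InUnit-clamp y

  hclamp : Carrier → N.Carrier
  hclamp y = ĥ (clampΓ y)

  hclamp-cong : ∀ {y y′} → y ≈ y′ → hclamp y N.≈ hclamp y′
  hclamp-cong y≈y′ = h.cong (∧-congʳ (∨-congʳ y≈y′))

  hclamp-InUnit : ∀ (e : ΓM.Carrier) → hclamp (proj₁ e) N.≈ ĥ e
  hclamp-InUnit (e , e∈) = h.cong (clamp-InUnit e∈)

  hclamp-0 : ∀ {y} → y ≈ 0# → hclamp y N.≈ N.0#
  hclamp-0 y≈0 = N.trans (hclamp-cong y≈0) (N.trans (hclamp-InUnit ΓM.0#) h.0-hom)

  hsum : ℕ → Carrier → N.Carrier
  hsum zero    y = N.0#
  hsum (suc m) y = hclamp y N.+ hsum m (rest y)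

  hsum-cong : ∀ m {y y′} → y ≈ y′ → hsum m y N.≈ hsum m y′
  hsum-cong zero    y≈y′ = N.refl
  hsum-cong (suc m) y≈y′ = N.+-cong (hclamp-cong y≈y′) (hsum-cong m (∨-congʳ (+-congʳ y≈y′)))

  hsum-nonneg : ∀ m y → N.0# N.≤ hsum m y
  hsum-nonneg zero    y = N.≤-refl
  hsum-nonneg (suc m) y = N.+-nonneg (ĥ-nonneg _) (hsum-nonneg m (rest y))

  hsum-suc : ∀ m {y} → y ∈[0, m ] → hsum (suc m) y N.≈ hsum m y
  hsum-suc zero    y∈ = N.trans (N.+-identityʳ _) (hclamp-0 (∈[0,0]⇒≈0 y∈))
  hsum-suc (suc m) y∈ = N.+-congˡ (hsum-suc m (rest-∈[0,] m y∈))

  -- h is additive on the unit interval up to carries: h(u ⊕ e) + h(u ⊙ e) = h u + h e.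
  hsum-+-InUnit : ∀ a {y} (e : ΓM.Carrier) → y ∈[0, a ] → hsum (suc a) (y + proj₁ e) N.≈ hsum a y N.+ ĥ e
  hsum-+-InUnit zero {y} e y∈ = begin
    hclamp (y + proj₁ e) N.+ N.0#  ≈⟨ N.+-identityʳ _ ⟩
    hclamp (y + proj₁ e)           ≈⟨ hclamp-cong (trans (+-congʳ (∈[0,0]⇒≈0 y∈)) (+-identityˡ _)) ⟩
    hclamp (proj₁ e)               ≈⟨ hclamp-InUnit e ⟩
    ĥ e                            ≈⟨ N.+-identityˡ _ ⟨
    N.0# N.+ ĥ e                   ∎
  hsum-+-InUnit (suc a) {y} e@(E , 0≤E , _) y∈@(0≤y , _) = begin
    hclamp (y + E) N.+ hsum (suc a) (rest (y + E))
      ≈⟨ N.+-cong (h.cong (clamp-+ 0≤y 0≤E)) (hsum-cong (suc a) (rest-+ 0≤y 0≤E)) ⟩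
    ĥ (u ΓM.⊕ e) N.+ hsum (suc a) (rest y + clamp y ⊙ E)
      ≈⟨ N.+-congˡ (hsum-+-InUnit a (u ΓM.⊙ e) (rest-∈[0,] a y∈)) ⟩
    ĥ (u ΓM.⊕ e) N.+ (hsum a (rest y) N.+ ĥ (u ΓM.⊙ e))
      ≈⟨ N.+-cong (h.⊕-hom u e) (N.+-congˡ (h.⊙-hom u e)) ⟩
    (ĥ u N.⊕ ĥ e) N.+ (hsum a (rest y) N.+ (ĥ u N.⊙ ĥ e))
      ≈⟨ N.+-congˡ (N.+-comm _ _) ⟩
    (ĥ u N.⊕ ĥ e) N.+ ((ĥ u N.⊙ ĥ e) N.+ hsum a (rest y))
      ≈⟨ N.+-assoc _ _ _ ⟨
    ((ĥ u N.⊕ ĥ e) N.+ (ĥ u N.⊙ ĥ e)) N.+ hsum a (rest y)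
      ≈⟨ N.+-congʳ (N.x⊕y+x⊙y≈x+y _ _) ⟩
    (ĥ u N.+ ĥ e) N.+ hsum a (rest y)
      ≈⟨ N.xy∙z≈xz∙y _ _ _ ⟩
    (ĥ u N.+ hsum a (rest y)) N.+ ĥ e
      ∎
    where u = clampΓ y

  hsum-+ : ∀ a b {y y′} → y ∈[0, a ] → y′ ∈[0, b ] → hsum (a ℕ.+ b) (y + y′) N.≈ hsum a y N.+ hsum b y′
  hsum-+ a zero {y} {y′} y∈ y′∈ = begin
    hsum (a ℕ.+ 0) (y + y′)  ≡⟨ ≡.cong (λ k → hsum k (y + y′)) (ℕ.+-identityʳ a) ⟩
    hsum a (y + y′)          ≈⟨ hsum-cong a (trans (+-congˡ (∈[0,0]⇒≈0 y′∈)) (+-identityʳ y)) ⟩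
    hsum a y                 ≈⟨ N.+-identityʳ _ ⟨
    hsum a y N.+ N.0#        ∎
  hsum-+ a (suc b) {y} {y′} y∈ y′∈@(0≤y′ , _) = begin
    hsum (a ℕ.+ suc b) (y + y′)                ≡⟨ ≡.cong (λ k → hsum k (y + y′)) (ℕ.+-suc a b) ⟩
    hsum (suc a ℕ.+ b) (y + y′)                ≈⟨ hsum-cong (suc a ℕ.+ b) split ⟩
    hsum (suc a ℕ.+ b) ((y + clamp y′) + rest y′)
      ≈⟨ hsum-+ (suc a) b (+-InUnit-∈[0,] y∈ (InUnit-clamp y′)) (rest-∈[0,] b y′∈) ⟩
    hsum (suc a) (y + clamp y′) N.+ hsum b (rest y′)
      ≈⟨ N.+-congʳ (hsum-+-InUnit a (clampΓ y′) y∈) ⟩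
    (hsum a y N.+ hclamp y′) N.+ hsum b (rest y′)
      ≈⟨ N.+-assoc _ _ _ ⟩
    hsum a y N.+ hsum (suc b) y′               ∎
    where
      split : y + y′ ≈ (y + clamp y′) + rest y′
      split = trans (+-congˡ (trans (sym (y∧1+rest≈y y′)) (+-congʳ (sym (clamp-nonneg 0≤y′)))))
                    (sym (+-assoc _ _ _))

  hclamp⊕hclamp-rest≈hclamp : ∀ {y} → 0# ≤ y → hclamp y N.⊕ hclamp (rest y) N.≈ hclamp y
  hclamp⊕hclamp-rest≈hclamp {y} 0≤y = N.trans (N.sym (h.⊕-hom (clampΓ y) (clampΓ (rest y))))
                                        (h.cong (clamp⊕clamp-rest≈clamp 0≤y))

  hclamp⊙hclamp-rest≈hclamp-rest : ∀ {y} → 0# ≤ y → hclamp y N.⊙ hclamp (rest y) N.≈ hclamp (rest y)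
  hclamp⊙hclamp-rest≈hclamp-rest {y} 0≤y = N.trans (N.sym (h.⊙-hom (clampΓ y) (clampΓ (rest y))))
                                        (h.cong (clamp⊙clamp-rest≈clamp-rest 0≤y))

  hsum-∧1 : ∀ m {y} → y ∈[0, m ] → hsum m y N.∧ N.1# N.≈ hclamp y
  hsum-∧1 zero    y∈ = N.trans (N.sym N.0≤1) (N.sym (hclamp-0 (∈[0,0]⇒≈0 y∈)))
  hsum-∧1 (suc m) {y} y∈@(0≤y , _) = N.good-pair⇒∧1 (ĥ-nonneg _) (begin
    hclamp y N.⊕ (hsum m (rest y) N.∧ N.1#) ≈⟨ N.⊕-cong N.refl (hsum-∧1 m (rest-∈[0,] m y∈)) ⟩
    hclamp y N.⊕ hclamp (rest y)            ≈⟨ hclamp⊕hclamp-rest≈hclamp 0≤y ⟩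
    hclamp y                                ∎)

  rest-hsum : ∀ m {y} → y ∈[0, suc m ] → N.rest (hsum (suc m) y) N.≈ hsum m (rest y)
  rest-hsum m {y} y∈@(0≤y , _) = N.good-pair⇒rest (ĥ-nonneg _) (hsum-nonneg m (rest y)) (begin
    hclamp y N.⊙ (hsum m (rest y) N.∧ N.1#) ≈⟨ N.⊙-cong N.refl first-digit ⟩
    hclamp y N.⊙ hclamp (rest y)            ≈⟨ hclamp⊙hclamp-rest≈hclamp-rest 0≤y ⟩
    hclamp (rest y)                         ≈⟨ first-digit ⟨
    hsum m (rest y) N.∧ N.1#                ∎)
    where
      first-digit = hsum-∧1 m (rest-∈[0,] m y∈)

  -- x ∈[± n ] is moved to [0, 2n], where hsum applies, and moved back in N.
  extend : ℕ → Carrier → N.Carrier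
  extend n x = hsum (n ℕ.+ n) (x + n · 1#) N.+ n N.· N.-1#

  extend-cong : ∀ n {x x′} → x ≈ x′ → extend n x N.≈ extend n x′
  extend-cong n x≈x′ = N.+-congʳ (hsum-cong (n ℕ.+ n) (+-congʳ x≈x′))

  extend-suc : ∀ n {x} → x ∈[± n ] → extend n x N.≈ extend (suc n) x
  extend-suc n {x} x∈ = N.sym (begin
    hsum (suc n ℕ.+ suc n) (x + (1# + n · 1#)) N.+ (N.-1# N.+ n N.· N.-1#)
      ≡⟨ ≡.cong (λ k → hsum (suc k) (x + (1# + n · 1#)) N.+ (N.-1# N.+ n N.· N.-1#)) (ℕ.+-suc n n) ⟩
    hsum (suc (suc (n ℕ.+ n))) (x + (1# + n · 1#)) N.+ (N.-1# N.+ n N.· N.-1#)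
      ≈⟨ N.+-congʳ (hsum-cong (suc (suc (n ℕ.+ n))) x+[1+n]≈y+1) ⟩
    hsum (suc (suc (n ℕ.+ n))) (y + 1#) N.+ (N.-1# N.+ n N.· N.-1#)
      ≈⟨ N.+-congʳ (hsum-suc (suc (n ℕ.+ n)) (+-InUnit-∈[0,] y∈ (0≤1 , ≤-refl))) ⟩
    hsum (suc (n ℕ.+ n)) (y + 1#) N.+ (N.-1# N.+ n N.· N.-1#)
      ≈⟨ N.+-congʳ (N.trans (hsum-+-InUnit (n ℕ.+ n) ΓM.1# y∈) (N.+-congˡ h.1-hom)) ⟩
    (hsum (n ℕ.+ n) y N.+ N.1#) N.+ (N.-1# N.+ n N.· N.-1#)
      ≈⟨ N.+-assoc _ _ _ ⟨
    ((hsum (n ℕ.+ n) y N.+ N.1#) N.+ N.-1#) N.+ n N.· N.-1#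
      ≈⟨ N.+-congʳ (N.x+1+-1≈x _) ⟩
    hsum (n ℕ.+ n) y N.+ n N.· N.-1#
      ∎)
    where
      y = x + n · 1#
      y∈ = shift-∈[0,] n x∈
      x+[1+n]≈y+1 : x + (1# + n · 1#) ≈ y + 1#
      x+[1+n]≈y+1 = trans (+-congˡ (+-comm 1# _)) (sym (+-assoc x _ _))

  extend-weaken : ∀ k {n x} → x ∈[± n ] → extend n x N.≈ extend (k ℕ.+ n) x
  extend-weaken zero    x∈ = N.refl
  extend-weaken (suc k) {n} x∈ = N.trans (extend-weaken k x∈) (extend-suc (k ℕ.+ n) (∈[±]-weaken k x∈))

  F : Carrier → N.Carrier
  F x = extend (bound x) x

  F≈extend : ∀ n {x} → x ∈[± n ] → F x N.≈ extend n x
  F≈extend n {x} x∈ = begin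
    extend (bound x) x            ≈⟨ extend-weaken n (bound-∈[±] x) ⟩
    extend (n ℕ.+ bound x) x      ≡⟨ ≡.cong (λ k → extend k x) (ℕ.+-comm n (bound x)) ⟩
    extend (bound x ℕ.+ n) x      ≈⟨ extend-weaken (bound x) x∈ ⟨
    extend n x                    ∎

  F-cong : ∀ {x x′} → x ≈ x′ → F x N.≈ F x′
  F-cong {x} x≈x′ = N.trans (extend-cong (bound x) x≈x′)
                            (N.sym (F≈extend (bound x) (∈[±]-resp-≈ x≈x′ (bound-∈[±] x))))

  F-+ : ∀ x x′ → F (x + x′) N.≈ F x N.+ F x′
  F-+ x x′ = begin
    F (x + x′)
      ≈⟨ F≈extend n (+-∈[±] (bound-∈[±] x) (bound-∈[±] x′)) ⟩
    hsum (n ℕ.+ n) ((x + x′) + n · 1#) N.+ n N.· N.-1#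
      ≡⟨ ≡.cong (λ k → hsum k ((x + x′) + n · 1#) N.+ n N.· N.-1#) (ℕ-interchange n₁ n₂ n₁ n₂) ⟩
    hsum ((n₁ ℕ.+ n₁) ℕ.+ (n₂ ℕ.+ n₂)) ((x + x′) + n · 1#) N.+ n N.· N.-1#
      ≈⟨ N.+-cong (hsum-cong ((n₁ ℕ.+ n₁) ℕ.+ (n₂ ℕ.+ n₂)) regroup) (N.·-homo-+ N.-1# n₁ n₂) ⟩
    hsum ((n₁ ℕ.+ n₁) ℕ.+ (n₂ ℕ.+ n₂)) ((x + n₁ · 1#) + (x′ + n₂ · 1#)) N.+ (n₁ N.· N.-1# N.+ n₂ N.· N.-1#)
      ≈⟨ N.+-congʳ (hsum-+ (n₁ ℕ.+ n₁) (n₂ ℕ.+ n₂) (shift-∈[0,] n₁ (bound-∈[±] x))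
                                                     (shift-∈[0,] n₂ (bound-∈[±] x′))) ⟩
    (hsum (n₁ ℕ.+ n₁) (x + n₁ · 1#) N.+ hsum (n₂ ℕ.+ n₂) (x′ + n₂ · 1#)) N.+ (n₁ N.· N.-1# N.+ n₂ N.· N.-1#)
      ≈⟨ N.interchange _ _ _ _ ⟩
    F x N.+ F x′
      ∎
    where
      n₁ = bound x
      n₂ = bound x′
      n = n₁ ℕ.+ n₂
      regroup : (x + x′) + n · 1# ≈ (x + n₁ · 1#) + (x′ + n₂ · 1#)
      regroup = trans (+-congˡ (·-homo-+ 1# n₁ n₂)) (interchange _ _ _ _)

  F-restricts-to-h : ∀ (e : ΓM.Carrier) → F (proj₁ e) N.≈ ĥ e
  F-restricts-to-h e@(E , 0≤E , E≤1) = begin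
    F E                                             ≈⟨ F≈extend 1 E∈[±1] ⟩
    hsum 2 (E + 1 · 1#) N.+ 1 N.· N.-1#             ≈⟨ N.+-congʳ (hsum-cong 2 (+-comm E _)) ⟩
    hsum 2 (1 · 1# + E) N.+ 1 N.· N.-1#             ≈⟨ N.+-congʳ (hsum-+-InUnit 1 e (0≤n·1 1 , ≤-refl)) ⟩
    (hsum 1 (1 · 1#) N.+ ĥ e) N.+ 1 N.· N.-1#       ≈⟨ N.+-cong (N.+-congʳ hsum-1-1≈1) (N.+-identityʳ N.-1#) ⟩
    (N.1# N.+ ĥ e) N.+ N.-1#                        ≈⟨ N.+-congʳ (N.+-comm _ _) ⟩
    (ĥ e N.+ N.1#) N.+ N.-1#                        ≈⟨ N.x+1+-1≈x _ ⟩
    ĥ e                                             ∎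
    where
      E∈[±1] : E ∈[± 1 ]
      E∈[±1] = ≤-trans (≤-reflexive (+-identityʳ -1#)) (≤-trans -1≤0 0≤E) , ≤-respʳ-≈ (sym (+-identityʳ 1#)) E≤1
      hsum-1-1≈1 : hsum 1 (1 · 1#) N.≈ N.1#
      hsum-1-1≈1 = N.trans (N.+-identityʳ _) (N.trans (hclamp-cong (+-identityʳ 1#))
                     (N.trans (hclamp-InUnit ΓM.1#) h.1-hom))

  F-0 : F 0# N.≈ N.0#
  F-0 = N.trans (F-restricts-to-h ΓM.0#) h.0-hom

  F-1 : F 1# N.≈ N.1#
  F-1 = N.trans (F-restricts-to-h ΓM.1#) h.1-hom

  F--1 : F -1# N.≈ N.-1#
  F--1 = begin
    F -1#                             ≈⟨ N.+-identityʳ _ ⟨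
    F -1# N.+ N.0#                    ≈⟨ N.+-congˡ N.1+-1≈0 ⟨
    F -1# N.+ (N.1# N.+ N.-1#)        ≈⟨ N.+-assoc _ _ _ ⟨
    (F -1# N.+ N.1#) N.+ N.-1#        ≈⟨ N.+-congʳ (N.trans (N.+-congˡ (N.sym F-1)) (N.sym (F-+ -1# 1#))) ⟩
    F (-1# + 1#) N.+ N.-1#            ≈⟨ N.+-congʳ (N.trans (F-cong -1+1≈0) F-0) ⟩
    N.0# N.+ N.-1#                    ≈⟨ N.+-identityˡ _ ⟩
    N.-1#                             ∎

  module LatticeOperation
    (_⋆_ : Carrier → Carrier → Carrier) (_⋆ᴺ_ : N.Carrier → N.Carrier → N.Carrier)
    (⋆ᴺ-cong : ∀ {a a′ b b′} → a N.≈ a′ → b N.≈ b′ → a ⋆ᴺ b N.≈ a′ ⋆ᴺ b′)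
    (0⋆ᴺ0 : N.0# ⋆ᴺ N.0# N.≈ N.0#)
    (hclamp-⋆ : ∀ y y′ → hclamp (y ⋆ y′) N.≈ hclamp y ⋆ᴺ hclamp y′)
    (rest-⋆ : ∀ y y′ → rest (y ⋆ y′) ≈ rest y ⋆ rest y′)
    (restᴺ-⋆ : ∀ a b → N.rest (a ⋆ᴺ b) N.≈ N.rest a ⋆ᴺ N.rest b)
    (∧1-⋆ᴺ : ∀ a b → (a ⋆ᴺ b) N.∧ N.1# N.≈ (a N.∧ N.1#) ⋆ᴺ (b N.∧ N.1#))
    (+-distrib-⋆ : ∀ a b c → (a ⋆ b) + c ≈ (a + c) ⋆ (b + c))
    (+ᴺ-distrib-⋆ᴺ : ∀ a b c → (a ⋆ᴺ b) N.+ c N.≈ (a N.+ c) ⋆ᴺ (b N.+ c))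
    (⋆-∈[±] : ∀ {n x x′} → x ∈[± n ] → x′ ∈[± n ] → x ⋆ x′ ∈[± n ])
    where

    hsum-⋆ : ∀ m {y y′} → y ∈[0, m ] → y′ ∈[0, m ] → hsum m (y ⋆ y′) N.≈ hsum m y ⋆ᴺ hsum m y′
    hsum-⋆ zero    y∈ y′∈ = N.sym 0⋆ᴺ0
    hsum-⋆ (suc m) {y} {y′} y∈ y′∈ = begin
      hclamp (y ⋆ y′) N.+ hsum m (rest (y ⋆ y′))
        ≈⟨ N.+-cong (hclamp-⋆ y y′) (N.trans (hsum-cong m (rest-⋆ y y′))
                                             (hsum-⋆ m (rest-∈[0,] m y∈) (rest-∈[0,] m y′∈))) ⟩
      (hclamp y ⋆ᴺ hclamp y′) N.+ (hsum m (rest y) ⋆ᴺ hsum m (rest y′))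
        ≈⟨ N.+-cong (⋆ᴺ-cong (hsum-∧1 (suc m) y∈) (hsum-∧1 (suc m) y′∈))
                    (⋆ᴺ-cong (rest-hsum m y∈) (rest-hsum m y′∈)) ⟨
      ((w N.∧ N.1#) ⋆ᴺ (w′ N.∧ N.1#)) N.+ (N.rest w ⋆ᴺ N.rest w′)
        ≈⟨ N.+-cong (∧1-⋆ᴺ w w′) (restᴺ-⋆ w w′) ⟨
      ((w ⋆ᴺ w′) N.∧ N.1#) N.+ N.rest (w ⋆ᴺ w′)
        ≈⟨ N.y∧1+rest≈y _ ⟩
      w ⋆ᴺ w′
        ∎
      where
        w = hsum (suc m) y
        w′ = hsum (suc m) y′

    F-⋆ : ∀ x x′ → F (x ⋆ x′) N.≈ F x ⋆ᴺ F x′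
    F-⋆ x x′ = begin
      F (x ⋆ x′)                                                ≈⟨ F≈extend n (⋆-∈[±] x∈ x′∈) ⟩
      hsum (n ℕ.+ n) ((x ⋆ x′) + n · 1#) N.+ n N.· N.-1#
        ≈⟨ N.+-congʳ (hsum-cong (n ℕ.+ n) (+-distrib-⋆ x x′ (n · 1#))) ⟩
      hsum (n ℕ.+ n) ((x + n · 1#) ⋆ (x′ + n · 1#)) N.+ n N.· N.-1#
        ≈⟨ N.+-congʳ (hsum-⋆ (n ℕ.+ n) (shift-∈[0,] n x∈) (shift-∈[0,] n x′∈)) ⟩
      (hsum (n ℕ.+ n) (x + n · 1#) ⋆ᴺ hsum (n ℕ.+ n) (x′ + n · 1#)) N.+ n N.· N.-1#
        ≈⟨ +ᴺ-distrib-⋆ᴺ _ _ _ ⟩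
      extend n x ⋆ᴺ extend n x′                                 ≈⟨ ⋆ᴺ-cong (F≈extend n x∈) (F≈extend n x′∈) ⟨
      F x ⋆ᴺ F x′                                               ∎
      where
        n = bound x ℕ.+ bound x′
        x∈ : x ∈[± n ]
        x∈ = ≡.subst (x ∈[±_]) (ℕ.+-comm (bound x′) (bound x)) (∈[±]-weaken (bound x′) (bound-∈[±] x))
        x′∈ : x′ ∈[± n ]
        x′∈ = ∈[±]-weaken (bound x) (bound-∈[±] x′)

  open LatticeOperation _∨_ N._∨_ N.∨-cong (N.∨-idem N.0#)
    (λ y y′ → N.trans (h.cong (clamp-∨ y y′)) (h.∨-hom (clampΓ y) (clampΓ y′)))
    rest-∨ N.rest-∨ (λ a b → proj₂ N.∧-distrib-∨ N.1# a b)
    (λ a b c → proj₂ +-distrib-∨ c a b) (λ a b c → proj₂ N.+-distrib-∨ c a b) ∨-∈[±]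
    renaming (F-⋆ to F-∨)
  open LatticeOperation _∧_ N._∧_ N.∧-cong (N.∧-idem N.0#)
    (λ y y′ → N.trans (h.cong (clamp-∧ y y′)) (h.∧-hom (clampΓ y) (clampΓ y′)))
    rest-∧ N.rest-∧ (λ a b → N.∧-distribʳ-∧ a b N.1#)
    (λ a b c → proj₂ +-distrib-∧ c a b) (λ a b c → proj₂ N.+-distrib-∧ c a b) ∧-∈[±]
    renaming (F-⋆ to F-∧)

  extension : ULMHom M N
  extension = record
    { ⟦_⟧ = F ; cong = F-cong ; +-hom = F-+ ; ∨-hom = F-∨ ; ∧-hom = F-∧
    ; 0-hom = F-0 ; 1-hom = F-1 ; -1-hom = F--1 }

theorem8p21 : ∀ {c ℓ : Level} →
    -- Γ is faithful
    (∀ (M N : ULM c ℓ) (f g : ULMHom M N) →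
       (∀ x → RawMVM._≈_ (Γ N) (Γ-map f x) (Γ-map g x)) →
       ∀ x → ULM._≈_ N (ULMHom.⟦ f ⟧ x) (ULMHom.⟦ g ⟧ x))
    ×
    -- Γ is full
    (∀ (M N : ULM c ℓ) (h : MVMHom (Γ M) (Γ N)) →
       Σ (ULMHom M N) λ f → ∀ x → RawMVM._≈_ (Γ N) (Γ-map f x) (MVMHom.⟦ h ⟧ x))
    ×
    -- Γ is essentially surjective
    (∀ (A : MVM c ℓ) → Σ (ULM c ℓ) λ M → MVMIso (Γ M) (MVM.raw A))
theorem8p21 =
    (λ M N f g agree → Faithful.faithful f g agree)
  , (λ M N h → Full.extension M N h , Full.F-restricts-to-h M N h)
  , (λ A → Ξ.ulm A , Ξ.Γ-iso A)
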